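{- Let $T$ be an unrooted binary phylogenetic $X$-tree, let $U$ be a $3$-cuttable unrooted binary phylogenetic network on $X$, and let $e$ be an edge of $U$ that is not a cut-edge. Let $U'$ be obtained from $U$ by eliminating $e$. Then: (i) $U'$ is a $3$-cuttable unrooted binary phylogenetic network on $X$; (ii) if $U'$ displays $T$, then $U$ displays $T$; and (iii) if $U$ displays $T$ and there is an embedding $\phi$ of $T$ in $U$ such that for each edge $f$ of $T$ the path $\phi(f)$ does not contain $e$, then $U'$ displays $T$.
   Context: An unrooted binary phylogenetic network on a non-empty finite set $X$ is a simple connected undirected graph whose internal vertices have degree $3$ and whose degree-$1$ vertices (leaves) are bijectively labeled by $X$; a tree such network is an unrooted binary phylogenetic $X$-tree. A cut-edge is an edge whose deletion disconnects the graph. $U$ is $3$-cuttable if every cycle contains a path of at least $3$ vertices each incident to a cut-edge. Eliminating a non-cut-edge $e$ means deleting $e$ and suppressing the two resulting degree-$2$ vertices (replacing each such vertex and its two incident edges by a single edge between its neighbors). $U$ displays $T$ if some subgraph of $U$ is a subdivision of $T$. An embedding of $T$ in $U$ is a map $\phi$ sending vertices of $T$ to vertices of $U$ and edges of $T$ to paths of $U$ such that: $\phi(x)=x$ for each leaf; $\phi$ is injective on vertices; $\phi(\{a,b\})$ is a path between $\phi(a)$ and $\phi(b)$; paths of distinct edges are edge-disjoint. ($U$ displays $T$ iff an embedding exists.) -}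

module Defs where

open import Data.Nat using (ℕ; zero; suc)
open import Data.Nat.Properties using (_<?_)
open import Data.Fin using (Fin; zero; suc; toℕ; fromℕ; fromℕ<; inject₁)
open import Data.Product using (Σ; _×_; _,_; proj₁; proj₂)
open import Data.Sum using (_⊎_; inj₁; inj₂)
open import Data.Bool using (Bool; true; false; T)
open import Data.Bool.Properties using (T-irrelevant)
open import Data.List using (List)
open import Data.List.Membership.Propositional using (_∈_)
open import Data.Empty using (⊥)
open import Relation.Nullary using (¬_; Dec; yes; no)
open import Relation.Nullary.Decidable using (False; fromWitnessFalse; toWitnessFalse; _⊎-dec_)
open import Relation.Binary using (DecidableEquality)
open import Relation.Binary.PropositionalEquality
  using (_≡_; _≢_; refl; sym; trans; cong; cong₂; subst)

-- Finite sets (Kuratowski-style: listable; graphs also carry decidable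
-- equality on vertices)

Finite : Set → Set
Finite A = Σ (List A) λ xs → (a : A) → a ∈ xs

-- Undirected (multi)graphs: a vertex set, an edge set, and for each
-- edge its two endpoints (orientation of the pair is irrelevant).
-- Simplicity is a separate predicate (needed since eliminating an
-- edge a priori may produce parallel edges or loops).

record Graph : Set₁ where
  field
    V    : Set
    E    : Set
    decV : DecidableEquality V
    ends : E → V × V

module _ (G : Graph) where
  open Graph G

  Inc : V → E → Set
  Inc w f = proj₁ (ends f) ≡ w ⊎ proj₂ (ends f) ≡ w

  Joins : E → V → V → Set
  Joins f x y = ends f ≡ (x , y) ⊎ ends f ≡ (y , x)

  data Walk : V → V → Set where
    []   : ∀ {x} → Walk x x
    step : ∀ {x y z} (f : E) → Joins f x y → Walk y z → Walk x z

  Connected : Set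
  Connected = ∀ x y → Walk x y

  deleteEdge : E → Graph
  deleteEdge e = record
    { V = V ; E = Σ E (λ f → f ≢ e) ; decV = decV ; ends = λ f → ends (proj₁ f) }

  Leaf : V → Set
  Leaf w = Σ E λ f → Inc w f × (∀ g → Inc w g → g ≡ f)

  Deg3 : V → Set
  Deg3 w = Σ E λ f₁ → Σ E λ f₂ → Σ E λ f₃ →
    f₁ ≢ f₂ × f₁ ≢ f₃ × f₂ ≢ f₃ ×
    Inc w f₁ × Inc w f₂ × Inc w f₃ ×
    (∀ g → Inc w g → g ≡ f₁ ⊎ g ≡ f₂ ⊎ g ≡ f₃)

  record Path (x y : V) : Set where
    field
      len      : ℕ
      vtx      : Fin (suc len) → V
      edg      : Fin len → E
      start    : vtx zero ≡ x
      finish   : vtx (fromℕ len) ≡ y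
      link     : ∀ i → Joins (edg i) (vtx (inject₁ i)) (vtx (suc i))
      vtx-inj  : ∀ i j → vtx i ≡ vtx j → i ≡ j

  OnPath : ∀ {x y} → E → Path x y → Set
  OnPath h P = Σ (Fin (Path.len P)) λ i → Path.edg P i ≡ h

  Internal : ∀ {x y} → V → Path x y → Set
  Internal {x} {y} w P =
    Σ (Fin (suc (Path.len P))) (λ i → Path.vtx P i ≡ w) × w ≢ x × w ≢ y

csuc : ∀ {m} → Fin (suc m) → Fin (suc m)
csuc {m} i with suc (toℕ i) <? suc m
... | yes p = fromℕ< p
... | no _  = zero

module _ (G : Graph) where
  open Graph G

  CutEdge : E → Set
  CutEdge e = ¬ Connected (deleteEdge G e)

  -- a cycle: distinct vertices vtx 0 .. vtx len, distinct edges,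
  -- edg i joining vtx i and vtx (i+1 mod (len+1))
  record Cycle : Set where
    field
      len     : ℕ
      vtx     : Fin (suc len) → V
      edg     : Fin (suc len) → E
      vtx-inj : ∀ i j → vtx i ≡ vtx j → i ≡ j
      edg-inj : ∀ i j → edg i ≡ edg j → i ≡ j
      link    : ∀ i → Joins G (edg i) (vtx i) (vtx (csuc i))

  IncCut : V → Set
  IncCut w = Σ E λ f → Inc G w f × CutEdge f

  ThreeCuttable : Set
  ThreeCuttable = (C : Cycle) →
    let open Cycle C in
    Σ (Fin (suc len)) λ i →
      IncCut (vtx i) × IncCut (vtx (csuc i)) × IncCut (vtx (csuc (csuc i)))

record IsNetwork (X : Set) (G : Graph) (lab : X → Graph.V G) : Set where
  open Graph G
  field
    finV       : Finite V
    finE       : Finite E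
    loopless   : ∀ f → proj₁ (ends f) ≢ proj₂ (ends f)
    noParallel : ∀ f g x y → Joins G f x y → Joins G g x y → f ≡ g
    connected  : Connected G
    degree     : ∀ w → Leaf G w ⊎ Deg3 G w
    lab-inj    : ∀ x y → lab x ≡ lab y → x ≡ y
    lab-leaf   : ∀ x → Leaf G (lab x)
    leaf-lab   : ∀ w → Leaf G w → Σ X λ x → lab x ≡ w

IsTree : (X : Set) (G : Graph) (lab : X → Graph.V G) → Set
IsTree X G lab = IsNetwork X G lab × (Cycle G → ⊥)

record Embedding {X : Set} (T : Graph) (labT : X → Graph.V T)
                 (U : Graph) (labU : X → Graph.V U) : Set where
  field
    φ        : Graph.V T → Graph.V U
    φ-inj    : ∀ a b → φ a ≡ φ b → a ≡ b
    φ-leaf   : ∀ x → φ (labT x) ≡ labU x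
    path     : (f : Graph.E T) →
               Path U (φ (proj₁ (Graph.ends T f))) (φ (proj₂ (Graph.ends T f)))
    edgeDisj : ∀ f g → f ≢ g → (h : Graph.E U) →
               OnPath U h (path f) → OnPath U h (path g) → ⊥

-- U displays T: some subgraph of U is a subdivision of T (leaf labels
-- respected), written out: T-vertices go injectively to U-vertices,
-- T-edges to paths whose internal vertices avoid the images of
-- T-vertices and are pairwise disjoint (and the paths are edge-disjoint).
Displays : {X : Set} (T : Graph) (labT : X → Graph.V T)
           (U : Graph) (labU : X → Graph.V U) → Set
Displays T labT U labU =
  Σ (Embedding T labT U labU) λ φ →
    let open Embedding φ renaming (φ to ϕ) in
    (∀ f a → ¬ Internal U (ϕ a) (path f)) ×
    (∀ f g → f ≢ g → ∀ w → Internal U w (path f) → Internal U w (path g) → ⊥)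

-- Eliminating a non-cut-edge e = {u , v}.
-- ElimData records the other edges at u (to a, b) and at v (to c, d).

record ElimData (G : Graph) (e : Graph.E G) : Set where
  open Graph G
  field
    a b c d    : V
    fa fb gc gd : E
    fa-j : Joins G fa (proj₁ (ends e)) a
    fb-j : Joins G fb (proj₁ (ends e)) b
    gc-j : Joins G gc (proj₂ (ends e)) c
    gd-j : Joins G gd (proj₂ (ends e)) d
    e≢fa : e ≢ fa
    e≢fb : e ≢ fb
    fa≢fb : fa ≢ fb
    e≢gc : e ≢ gc
    e≢gd : e ≢ gd
    gc≢gd : gc ≢ gd
    u-edges : ∀ g → Inc G (proj₁ (ends e)) g → g ≡ e ⊎ g ≡ fa ⊎ g ≡ fb
    v-edges : ∀ g → Inc G (proj₂ (ends e)) g → g ≡ e ⊎ g ≡ gc ⊎ g ≡ gd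

module Elim {X : Set} (G : Graph) (lab : X → Graph.V G)
            (nG : IsNetwork X G lab) (e : Graph.E G) (D : ElimData G e) where
  open Graph G
  open ElimData D
  open IsNetwork nG

  u v : V
  u = proj₁ (ends e)
  v = proj₂ (ends e)

  Keep : V → Set
  Keep w = False (decV w u) × False (decV w v)

  V' : Set
  V' = Σ V Keep

  incDec : (w : V) (f : E) → Dec (Inc G w f)
  incDec w f = decV (proj₁ (ends f)) w ⊎-dec decV (proj₂ (ends f)) w

  -- edges of U' : old edges not incident to u or v, plus two new edges
  -- (true ↦ {a , b}, false ↦ {c , d})
  E' : Set
  E' = Σ E (λ f → False (incDec u f) × False (incDec v f)) ⊎ Bool

  keep : (w : V) → w ≢ u → w ≢ v → V'
  keep w p q = w , fromWitnessFalse p , fromWitnessFalse q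

  notLoop : ∀ {f x y} → Joins G f x y → x ≢ y
  notLoop {f} (inj₁ q) p =
    loopless f (trans (cong proj₁ q) (trans p (sym (cong proj₂ q))))
  notLoop {f} (inj₂ q) p =
    loopless f (trans (cong proj₁ q) (trans (sym p) (sym (cong proj₂ q))))

  joinsInc : ∀ {f x y} → Joins G f x y → Inc G x f
  joinsInc (inj₁ q) = inj₁ (cong proj₁ q)
  joinsInc (inj₂ q) = inj₂ (cong proj₂ q)

  a≢u : a ≢ u
  a≢u p = notLoop fa-j (sym p)
  b≢u : b ≢ u
  b≢u p = notLoop fb-j (sym p)
  c≢v : c ≢ v
  c≢v p = notLoop gc-j (sym p)
  d≢v : d ≢ v
  d≢v p = notLoop gd-j (sym p)

  a≢v : a ≢ v
  a≢v p = e≢fa (noParallel e fa u v (inj₁ refl) (subst (Joins G fa u) p fa-j))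
  b≢v : b ≢ v
  b≢v p = e≢fb (noParallel e fb u v (inj₁ refl) (subst (Joins G fb u) p fb-j))
  c≢u : c ≢ u
  c≢u p = e≢gc (noParallel e gc v u (inj₂ refl) (subst (Joins G gc v) p gc-j))
  d≢u : d ≢ u
  d≢u p = e≢gd (noParallel e gd v u (inj₂ refl) (subst (Joins G gd v) p gd-j))

  ends' : E' → V' × V'
  ends' (inj₁ (f , p , q)) =
      keep (proj₁ (ends f)) (λ r → toWitnessFalse p (inj₁ r))
                            (λ r → toWitnessFalse q (inj₁ r))
    , keep (proj₂ (ends f)) (λ r → toWitnessFalse p (inj₂ r))
                            (λ r → toWitnessFalse q (inj₂ r))
  ends' (inj₂ true)  = keep a a≢u a≢v , keep b b≢u b≢v
  ends' (inj₂ false) = keep c c≢u c≢v , keep d d≢u d≢v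

  decV' : DecidableEquality V'
  decV' (w , p , q) (w' , p' , q') with decV w w'
  ... | no ne = no λ r → ne (cong proj₁ r)
  ... | yes refl = yes (cong₂ (λ s t → w , s , t) (T-irrelevant p p') (T-irrelevant q q'))

  U' : Graph
  U' = record { V = V' ; E = E' ; decV = decV' ; ends = ends' }

  leaf≢u : ∀ x → lab x ≢ u
  leaf≢u x p with lab-leaf x
  ... | f , _ , uniq =
    e≢fa (trans (uniq e (subst (λ w → Inc G w e) (sym p) (inj₁ refl)))
                (sym (uniq fa (subst (λ w → Inc G w fa) (sym p) (joinsInc fa-j)))))

  leaf≢v : ∀ x → lab x ≢ v
  leaf≢v x p with lab-leaf x
  ... | f , _ , uniq =
    e≢gc (trans (uniq e (subst (λ w → Inc G w e) (sym p) (inj₂ refl)))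
                (sym (uniq gc (subst (λ w → Inc G w gc) (sym p) (joinsInc gc-j)))))

  lab' : X → V'
  lab' x = keep (lab x) (leaf≢u x) (leaf≢v x)

module Submission where

-- Write u, v for the ends of e, a, b for the other neighbours of u, and c, d for those
-- of v; U' replaces u, v by the edges ab and cd.  A walk of U' expands to a walk of U by
-- routing ab through u and cd through v, and a walk of U − e between vertices other than
-- u, v contracts to a walk of U' by replacing each passage a u b by ab.  Expanding the
-- paths of an embedding of T in U' gives (ii); contracting the paths of an embedding in U
-- that avoids e gives (iii), since no vertex of T is sent to u or v: besides e they have
-- only two edges, too few for the three paths at an internal vertex of T.
-- For (i), the edge correspondence preserves degrees, and U' is connected because U − e
-- is.  Neither u nor v is incident to a cut-edge once both its other edges lie on a
-- cycle, as e is not a cut-edge.  So a triangle or square through u or v would violate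
-- 3-cuttability, which rules out the parallel edges in U'; and the three consecutive
-- cut-incident vertices that the expansion of a cycle of U' must contain avoid u and v,
-- hence are consecutive on the cycle of U'.  Their cut-edges remain cut-edges in U', as a
-- walk of U' avoiding the image of an edge expands to a walk of U avoiding the edge.

open import Defs
open import Data.Product using (_×_)
open import Relation.Nullary using (¬_)
open import Data.Nat as ℕ using (ℕ; zero; suc; _≤_; _<_; z≤n; s≤s)
import Data.Nat.Properties as ℕ
open import Data.Fin using (Fin; zero; suc; toℕ; fromℕ; inject₁)
import Data.Fin.Properties as Fin
open import Data.Product using (Σ; ∃; _,_; proj₁; proj₂)
open import Data.Sum using (_⊎_; inj₁; inj₂; [_,_]′)
open import Data.Bool as Bool using (Bool; true; false; not)
open import Data.Bool.Properties using (T-irrelevant; not-¬; ¬-not)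
open import Data.List using (List; []; _∷_; _++_; length; map; lookup; tabulate; concatMap)
open import Data.List.Properties using (tabulate-lookup)
open import Data.List.Membership.Propositional using (_∈_; _∉_)
open import Data.List.Membership.Propositional.Properties
  using (∈-++⁺ˡ; ∈-++⁺ʳ; ∈-++⁻; ∈-lookup; ∈-map⁺; ∈-tabulate⁺; ∈-tabulate⁻)
open import Data.List.Relation.Unary.All using (All; []; _∷_)
open import Data.List.Relation.Unary.All.Properties using (All¬⇒¬Any; ¬Any⇒All¬)
open import Data.List.Relation.Unary.Any as Any using (Any; here; there)
open import Data.List.Relation.Unary.Any.Properties as AnyP using (lookup-index)
open import Data.List.Relation.Unary.AllPairs using ([]; _∷_)
open import Data.List.Relation.Unary.Unique.Propositional using (Unique)
import Data.List.Relation.Unary.Unique.Propositional.Properties as Unique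
open import Data.List.Relation.Binary.Disjoint.Propositional using (Disjoint)
open import Data.List.Relation.Binary.Sublist.Propositional using (_⊆_; []; _∷_; _∷ʳ_)
open import Data.List.Relation.Binary.Sublist.Propositional.Properties using (All-resp-⊆)
open import Data.Empty using (⊥; ⊥-elim)
open import Function using (_∘_; case_of_)
open import Relation.Binary using (DecidableEquality)
open import Data.Product.Properties using (≡-dec)
open import Relation.Nullary using (Dec; yes; no; ¬?)
open import Relation.Nullary.Decidable
  using (False; fromWitnessFalse; toWitnessFalse; T?; _×-dec_; decidable-stable)
open import Relation.Binary.PropositionalEquality

module _ {A : Set} where

  ∉⇒All≢ : ∀ {x : A} {xs} → x ∉ xs → All (x ≢_) xs
  ∉⇒All≢ = ¬Any⇒All¬ _

  All≢⇒∉ : ∀ {x : A} {xs} → All (x ≢_) xs → x ∉ xs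
  All≢⇒∉ = All¬⇒¬Any

  Unique-tabulate⇒injective : ∀ {n} {f : Fin n → A} → Unique (tabulate f) → ∀ {i j} → f i ≡ f j → i ≡ j
  Unique-tabulate⇒injective _ {zero} {zero} _ = refl
  Unique-tabulate⇒injective {f = f} (f₀∉ ∷ _) {zero} {suc j} eq =
    ⊥-elim (All≢⇒∉ f₀∉ (subst (_∈ tabulate (f ∘ suc)) (sym eq) (∈-tabulate⁺ j)))
  Unique-tabulate⇒injective {f = f} (f₀∉ ∷ _) {suc i} {zero} eq =
    ⊥-elim (All≢⇒∉ f₀∉ (subst (_∈ tabulate (f ∘ suc)) eq (∈-tabulate⁺ i)))
  Unique-tabulate⇒injective (_ ∷ u) {suc i} {suc j} eq = cong suc (Unique-tabulate⇒injective u eq)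

  Unique-⊆⇒length≤ : ∀ {xs ys : List A} → Unique xs → (∀ {z} → z ∈ xs → z ∈ ys) → length xs ≤ length ys
  Unique-⊆⇒length≤ {xs} {ys} u sub = Fin.injective⇒≤ position-injective
    where
    position : Fin (length xs) → Fin (length ys)
    position i = Any.index (sub (∈-lookup i))
    position-injective : ∀ {i j} → position i ≡ position j → i ≡ j
    position-injective {i} {j} eq = Unique-tabulate⇒injective (subst Unique (sym (tabulate-lookup xs)) u) (begin
      lookup xs i             ≡⟨ lookup-index (sub (∈-lookup i)) ⟩
      lookup ys (position i)  ≡⟨ cong (lookup ys) eq ⟩
      lookup ys (position j)  ≡⟨ lookup-index (sub (∈-lookup j)) ⟨
      lookup xs j             ∎)
      where open ≡-Reasoning

  Unique-middle : ∀ (xs : List A) {y ys} → Unique (xs ++ y ∷ ys) → y ∉ xs × y ∉ ys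
  Unique-middle []       (y∉ ∷ _) = (λ ()) , All≢⇒∉ y∉
  Unique-middle (x ∷ xs) (x∉ ∷ u) =
    (λ { (here refl) → All≢⇒∉ x∉ (∈-++⁺ʳ xs (here refl)) ; (there y∈) → proj₁ (Unique-middle xs u) y∈ })
    , proj₂ (Unique-middle xs u)

  Unique-resp-⊇ : ∀ {xs ys : List A} → xs ⊆ ys → Unique ys → Unique xs
  Unique-resp-⊇ []         []       = []
  Unique-resp-⊇ (_ ∷ʳ s)   (_ ∷ u)  = Unique-resp-⊇ s u
  Unique-resp-⊇ (refl ∷ s) (y∉ ∷ u) = All-resp-⊆ s y∉ ∷ Unique-resp-⊇ s u

-- Walks, paths and cycles

csuc-cases : ∀ {m} (i : Fin (suc m)) → toℕ (csuc i) ≡ suc (toℕ i) ⊎ (toℕ i ≡ m × csuc i ≡ zero)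
csuc-cases {m} i with suc (toℕ i) ℕ.<? suc m
... | yes p = inj₁ (Fin.toℕ-fromℕ< p)
... | no ¬p = inj₂ (ℕ.≤-antisym (ℕ.≤-pred (Fin.toℕ<n i)) (ℕ.≤-pred (ℕ.≮⇒≥ ¬p)) , refl)

csuc-inject₁ : ∀ {m} (i : Fin m) → csuc (inject₁ i) ≡ suc i
csuc-inject₁ i with csuc-cases (inject₁ i)
... | inj₁ p       = Fin.toℕ-injective (trans p (cong suc (Fin.toℕ-inject₁ i)))
... | inj₂ (p , _) = ⊥-elim (ℕ.<-irrefl (trans (sym (Fin.toℕ-inject₁ i)) p) (Fin.toℕ<n i))

csuc-fromℕ : ∀ m → csuc (fromℕ m) ≡ zero
csuc-fromℕ m with csuc-cases (fromℕ m)
... | inj₁ p       = ⊥-elim (ℕ.<-irrefl (trans p (cong suc (Fin.toℕ-fromℕ m))) (Fin.toℕ<n (csuc (fromℕ m))))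
... | inj₂ (_ , q) = q

module Walks (G : Graph) where
  open Graph G

  joins-sym : ∀ {f x y} → Joins G f x y → Joins G f y x
  joins-sym (inj₁ p) = inj₂ p
  joins-sym (inj₂ p) = inj₁ p

  joins⇒incˡ : ∀ {f x y} → Joins G f x y → Inc G x f
  joins⇒incˡ (inj₁ p) = inj₁ (cong proj₁ p)
  joins⇒incˡ (inj₂ p) = inj₂ (cong proj₂ p)

  joins⇒incʳ : ∀ {f x y} → Joins G f x y → Inc G y f
  joins⇒incʳ = joins⇒incˡ ∘ joins-sym

  joins-ends : ∀ {f x y p q} → Joins G f x y → Joins G f p q → (x ≡ p × y ≡ q) ⊎ (x ≡ q × y ≡ p)
  joins-ends (inj₁ r) (inj₁ s) = inj₁ (cong proj₁ (trans (sym r) s) , cong proj₂ (trans (sym r) s))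
  joins-ends (inj₁ r) (inj₂ s) = inj₂ (cong proj₁ (trans (sym r) s) , cong proj₂ (trans (sym r) s))
  joins-ends (inj₂ r) (inj₁ s) = inj₂ (cong proj₂ (trans (sym r) s) , cong proj₁ (trans (sym r) s))
  joins-ends (inj₂ r) (inj₂ s) = inj₁ (cong proj₂ (trans (sym r) s) , cong proj₁ (trans (sym r) s))

  joins-other-end : ∀ {f x y y′} → Joins G f x y → Joins G f x y′ → y ≡ y′
  joins-other-end j j′ with joins-ends j j′
  ... | inj₁ (_ , q) = q
  ... | inj₂ (p , q) = trans q p

  inc⇒endpoint : ∀ {f x y z} → Joins G f x y → Inc G z f → z ≡ x ⊎ z ≡ y
  inc⇒endpoint (inj₁ r) (inj₁ s) = inj₁ (trans (sym s) (cong proj₁ r))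
  inc⇒endpoint (inj₁ r) (inj₂ s) = inj₂ (trans (sym s) (cong proj₂ r))
  inc⇒endpoint (inj₂ r) (inj₁ s) = inj₂ (trans (sym s) (cong proj₁ r))
  inc⇒endpoint (inj₂ r) (inj₂ s) = inj₁ (trans (sym s) (cong proj₂ r))

  joins-resp-ends : ∀ {f f′ x y} → ends f′ ≡ ends f → Joins G f x y → Joins G f′ x y
  joins-resp-ends r (inj₁ s) = inj₁ (trans r s)
  joins-resp-ends r (inj₂ s) = inj₂ (trans r s)

  W : V → V → Set
  W = Walk G

  wlength : ∀ {x y} → W x y → ℕ
  wlength []           = 0
  wlength (step _ _ w) = suc (wlength w)

  vertices : ∀ {x y} → W x y → List V
  vertices {x} []           = x ∷ []
  vertices {x} (step _ _ w) = x ∷ vertices w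

  -- On a closed walk the tails are the vertices of the cycle it traces.
  tails : ∀ {x y} → W x y → List V
  tails     []           = []
  tails {x} (step _ _ w) = x ∷ tails w

  edges : ∀ {x y} → W x y → List E
  edges []           = []
  edges (step f _ w) = f ∷ edges w

  infixr 5 _++ʷ_
  _++ʷ_ : ∀ {x y z} → W x y → W y z → W x z
  []           ++ʷ w′ = w′
  step f j w   ++ʷ w′ = step f j (w ++ʷ w′)

  reverseʷ : ∀ {x y} → W x y → W y x
  reverseʷ []           = []
  reverseʷ (step f j w) = reverseʷ w ++ʷ step f (joins-sym j) []

  castʷ : ∀ {x x′ y y′} → x ≡ x′ → y ≡ y′ → W x y → W x′ y′
  castʷ refl refl w = w

  edges-++ʷ : ∀ {x y z} (w : W x y) (w′ : W y z) → edges (w ++ʷ w′) ≡ edges w ++ edges w′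
  edges-++ʷ []           w′ = refl
  edges-++ʷ (step f _ w) w′ = cong (f ∷_) (edges-++ʷ w w′)

  tails-++ʷ : ∀ {x y z} (w : W x y) (w′ : W y z) → tails (w ++ʷ w′) ≡ tails w ++ tails w′
  tails-++ʷ []           w′ = refl
  tails-++ʷ (step _ _ w) w′ = cong (_ ∷_) (tails-++ʷ w w′)

  ∈-edges-++ʷ⁻ : ∀ {x y z h} (w : W x y) (w′ : W y z) → h ∈ edges (w ++ʷ w′) → h ∈ edges w ⊎ h ∈ edges w′
  ∈-edges-++ʷ⁻ w w′ h∈ = ∈-++⁻ (edges w) (subst (_ ∈_) (edges-++ʷ w w′) h∈)

  ∈-edges-++ʷ⁺ˡ : ∀ {x y z h} (w : W x y) (w′ : W y z) → h ∈ edges w → h ∈ edges (w ++ʷ w′)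
  ∈-edges-++ʷ⁺ˡ w w′ h∈ = subst (_ ∈_) (sym (edges-++ʷ w w′)) (∈-++⁺ˡ h∈)

  ∈-edges-++ʷ⁺ʳ : ∀ {x y z h} (w : W x y) (w′ : W y z) → h ∈ edges w′ → h ∈ edges (w ++ʷ w′)
  ∈-edges-++ʷ⁺ʳ w w′ h∈ = subst (_ ∈_) (sym (edges-++ʷ w w′)) (∈-++⁺ʳ (edges w) h∈)

  ∈-edges-reverseʷ : ∀ {x y h} (w : W x y) → h ∈ edges (reverseʷ w) → h ∈ edges w
  ∈-edges-reverseʷ (step f j w) h∈ with ∈-edges-++ʷ⁻ (reverseʷ w) (step f (joins-sym j) []) h∈
  ... | inj₁ h∈w        = there (∈-edges-reverseʷ w h∈w)
  ... | inj₂ (here h≡f) = here h≡f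

  tails⊆vertices : ∀ {x y z} (w : W x y) → z ∈ tails w → z ∈ vertices w
  tails⊆vertices (step _ _ w) (here p)  = here p
  tails⊆vertices (step _ _ w) (there p) = there (tails⊆vertices w p)

  ∈-vertices⇒∈-tails⊎target : ∀ {x y z} (w : W x y) → z ∈ vertices w → z ∈ tails w ⊎ z ≡ y
  ∈-vertices⇒∈-tails⊎target []           (here p)  = inj₂ p
  ∈-vertices⇒∈-tails⊎target (step _ _ w) (here p)  = inj₁ (here p)
  ∈-vertices⇒∈-tails⊎target (step _ _ w) (there p) with ∈-vertices⇒∈-tails⊎target w p
  ... | inj₁ q = inj₁ (there q)
  ... | inj₂ q = inj₂ q

  source∈vertices : ∀ {x y} (w : W x y) → x ∈ vertices w
  source∈vertices []           = here refl
  source∈vertices (step _ _ _) = here refl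

  target∈vertices : ∀ {x y} (w : W x y) → y ∈ vertices w
  target∈vertices []           = here refl
  target∈vertices (step _ _ w) = there (target∈vertices w)

  ∈-tails⇒nonempty : ∀ {x y z} (w : W x y) → z ∈ tails w → 0 < wlength w
  ∈-tails⇒nonempty (step _ _ _) _ = s≤s z≤n

  length-vertices : ∀ {x y} (w : W x y) → length (vertices w) ≡ suc (wlength w)
  length-vertices []           = refl
  length-vertices (step _ _ w) = cong suc (length-vertices w)

  data Dart : ∀ {x y} → W x y → E → V → V → Set where
    now   : ∀ {x y z f j} {w : W y z} → Dart (step {x = x} f j w) f x y
    later : ∀ {x y z f j g p q} {w : W y z} → Dart w g p q → Dart (step {x = x} f j w) g p q

  dart-joins : ∀ {x y f p q} {w : W x y} → Dart w f p q → Joins G f p q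
  dart-joins (now {j = j}) = j
  dart-joins (later d)     = dart-joins d

  dart-tail∈vertices : ∀ {x y f p q} {w : W x y} → Dart w f p q → p ∈ vertices w
  dart-tail∈vertices now       = here refl
  dart-tail∈vertices (later d) = there (dart-tail∈vertices d)

  dart-head∈vertices : ∀ {x y f p q} {w : W x y} → Dart w f p q → q ∈ vertices w
  dart-head∈vertices {w = step _ _ w} now = there (source∈vertices w)
  dart-head∈vertices (later d)            = there (dart-head∈vertices d)

  edge⇒dart : ∀ {x y f} (w : W x y) → f ∈ edges w → ∃ λ p → ∃ λ q → Dart w f p q
  edge⇒dart (step f j w) (here refl) = _ , _ , now
  edge⇒dart (step f j w) (there f∈) with edge⇒dart w f∈
  ... | p , q , d = p , q , later d

  dart-++ʷ : ∀ {x y z f p q} (w : W x y) (w′ : W y z) → Dart (w ++ʷ w′) f p q → Dart w f p q ⊎ Dart w′ f p q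
  dart-++ʷ []           w′ d         = inj₂ d
  dart-++ʷ (step _ _ w) w′ now       = inj₁ now
  dart-++ʷ (step _ _ w) w′ (later d) with dart-++ʷ w w′ d
  ... | inj₁ d′ = inj₁ (later d′)
  ... | inj₂ d′ = inj₂ d′

  Unique-vertices⇒Unique-edges : ∀ {x y} (w : W x y) → Unique (vertices w) → Unique (edges w)
  Unique-vertices⇒Unique-edges []           _        = []
  Unique-vertices⇒Unique-edges (step f j w) (x∉ ∷ u) =
    ∉⇒All≢ (All≢⇒∉ x∉ ∘ source-revisited) ∷ Unique-vertices⇒Unique-edges w u
    where
    source-revisited : f ∈ edges w → _ ∈ vertices w
    source-revisited f∈ with edge⇒dart w f∈
    ... | _ , _ , d with joins-ends j (dart-joins d)
    ... | inj₁ (r , _) = subst (_∈ vertices w) (sym r) (dart-tail∈vertices d)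
    ... | inj₂ (r , _) = subst (_∈ vertices w) (sym r) (dart-head∈vertices d)

  Unique-vertices⇒Unique-tails : ∀ {x y} (w : W x y) → Unique (vertices w) → Unique (tails w)
  Unique-vertices⇒Unique-tails []           _        = []
  Unique-vertices⇒Unique-tails (step _ _ w) (x∉ ∷ u) =
    ∉⇒All≢ (All≢⇒∉ x∉ ∘ tails⊆vertices w) ∷ Unique-vertices⇒Unique-tails w u

  Unique-vertices⇒target∉tails : ∀ {x y} (w : W x y) → Unique (vertices w) → y ∉ tails w
  Unique-vertices⇒target∉tails (step _ _ w) (x∉ ∷ _) (here refl) = All≢⇒∉ x∉ (target∈vertices w)
  Unique-vertices⇒target∉tails (step _ _ w) (_ ∷ u)  (there y∈)  = Unique-vertices⇒target∉tails w u y∈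

  Unique-tails⇒Unique-vertices : ∀ {x y} (w : W x y) → Unique (tails w) → y ∉ tails w → Unique (vertices w)
  Unique-tails⇒Unique-vertices []           _        _   = [] ∷ []
  Unique-tails⇒Unique-vertices (step _ _ w) (x∉ ∷ u) y∉ =
    ∉⇒All≢ (λ x∈ → [ All≢⇒∉ x∉ , (λ { refl → y∉ (here refl) }) ]′ (∈-vertices⇒∈-tails⊎target w x∈))
    ∷ Unique-tails⇒Unique-vertices w u (y∉ ∘ there)

  dropUntil : ∀ {x y z} (w : W z y) → x ∈ vertices w → W x y
  dropUntil []           (here refl) = []
  dropUntil (step f j w) (here refl) = step f j w
  dropUntil (step _ _ w) (there x∈)  = dropUntil w x∈

  Unique-dropUntil : ∀ {x y z} (w : W z y) (x∈ : x ∈ vertices w) →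
                     Unique (vertices w) → Unique (vertices (dropUntil w x∈))
  Unique-dropUntil []           (here refl) u       = u
  Unique-dropUntil (step _ _ w) (here refl) u       = u
  Unique-dropUntil (step _ _ w) (there x∈)  (_ ∷ u) = Unique-dropUntil w x∈ u

  open import Data.List.Membership.DecPropositional decV using (_∈?_)

  loopErase : ∀ {x y} → W x y → Σ (W x y) (Unique ∘ vertices)
  loopErase     []           = [] , [] ∷ []
  loopErase {x} (step f j w) with loopErase w
  ... | w′ , u with x ∈? vertices w′
  ...   | yes x∈ = dropUntil w′ x∈ , Unique-dropUntil w′ x∈ u
  ...   | no  x∉ = step f j w′ , ∉⇒All≢ x∉ ∷ u

  fromIndexed : (n : ℕ) (vtx : Fin (suc n) → V) (edg : Fin n → E) →
                (∀ i → Joins G (edg i) (vtx (inject₁ i)) (vtx (suc i))) → W (vtx zero) (vtx (fromℕ n))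
  fromIndexed zero    vtx edg link = []
  fromIndexed (suc n) vtx edg link =
    step (edg zero) (link zero) (fromIndexed n (vtx ∘ suc) (edg ∘ suc) (λ i → link (suc i)))

  vertices-fromIndexed : ∀ n vtx edg link → vertices (fromIndexed n vtx edg link) ≡ tabulate vtx
  vertices-fromIndexed zero    vtx edg link = refl
  vertices-fromIndexed (suc n) vtx edg link = cong (vtx zero ∷_) (vertices-fromIndexed n _ _ _)

  tails-fromIndexed : ∀ n vtx edg link → tails (fromIndexed n vtx edg link) ≡ tabulate (vtx ∘ inject₁)
  tails-fromIndexed zero    vtx edg link = refl
  tails-fromIndexed (suc n) vtx edg link = cong (vtx zero ∷_) (tails-fromIndexed n _ _ _)

  edges-fromIndexed : ∀ n vtx edg link → edges (fromIndexed n vtx edg link) ≡ tabulate edg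
  edges-fromIndexed zero    vtx edg link = refl
  edges-fromIndexed (suc n) vtx edg link = cong (edg zero ∷_) (edges-fromIndexed n _ _ _)

  dart-fromIndexed : ∀ n vtx edg link {f p q} → Dart (fromIndexed n vtx edg link) f p q →
                     ∃ λ i → edg i ≡ f × vtx (inject₁ i) ≡ p × vtx (suc i) ≡ q
  dart-fromIndexed (suc n) vtx edg link now = zero , refl , refl , refl
  dart-fromIndexed (suc n) vtx edg link (later d) with dart-fromIndexed n _ _ _ d
  ... | i , r = suc i , r

  vertices-castʷ : ∀ {x x′ y y′} (p : x ≡ x′) (q : y ≡ y′) (w : W x y) → vertices (castʷ p q w) ≡ vertices w
  vertices-castʷ refl refl w = refl

  tails-castʷ : ∀ {x x′ y y′} (p : x ≡ x′) (q : y ≡ y′) (w : W x y) → tails (castʷ p q w) ≡ tails w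
  tails-castʷ refl refl w = refl

  edges-castʷ : ∀ {x x′ y y′} (p : x ≡ x′) (q : y ≡ y′) (w : W x y) → edges (castʷ p q w) ≡ edges w
  edges-castʷ refl refl w = refl

  dart-castʷ : ∀ {x x′ y y′ f a b} (p : x ≡ x′) (q : y ≡ y′) (w : W x y) → Dart (castʷ p q w) f a b → Dart w f a b
  dart-castʷ refl refl w d = d

  vertexAt : ∀ {x y} (w : W x y) → Fin (suc (wlength w)) → V
  vertexAt {x} w            zero    = x
  vertexAt     (step _ _ w) (suc i) = vertexAt w i

  tailAt : ∀ {x y} (w : W x y) → Fin (wlength w) → V
  tailAt {x} (step _ _ w) zero    = x
  tailAt     (step _ _ w) (suc i) = tailAt w i

  edgeAt : ∀ {x y} (w : W x y) → Fin (wlength w) → E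
  edgeAt (step f _ w) zero    = f
  edgeAt (step _ _ w) (suc i) = edgeAt w i

  tabulate-vertexAt : ∀ {x y} (w : W x y) → tabulate (vertexAt w) ≡ vertices w
  tabulate-vertexAt []           = refl
  tabulate-vertexAt (step _ _ w) = cong (_ ∷_) (tabulate-vertexAt w)

  tabulate-tailAt : ∀ {x y} (w : W x y) → tabulate (tailAt w) ≡ tails w
  tabulate-tailAt []           = refl
  tabulate-tailAt (step _ _ w) = cong (_ ∷_) (tabulate-tailAt w)

  tabulate-edgeAt : ∀ {x y} (w : W x y) → tabulate (edgeAt w) ≡ edges w
  tabulate-edgeAt []           = refl
  tabulate-edgeAt (step f _ w) = cong (f ∷_) (tabulate-edgeAt w)

  vertexAt-last : ∀ {x y} (w : W x y) → vertexAt w (fromℕ (wlength w)) ≡ y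
  vertexAt-last []           = refl
  vertexAt-last (step _ _ w) = vertexAt-last w

  vertexAt-link : ∀ {x y} (w : W x y) i → Joins G (edgeAt w i) (vertexAt w (inject₁ i)) (vertexAt w (suc i))
  vertexAt-link (step _ j w) zero    = j
  vertexAt-link (step _ _ w) (suc i) = vertexAt-link w i

  dart-edgeAt : ∀ {x y} (w : W x y) i → Dart w (edgeAt w i) (tailAt w i) (vertexAt w (suc i))
  dart-edgeAt (step _ _ w)            zero    = now
  dart-edgeAt (step _ _ (step _ _ w)) (suc i) = later (dart-edgeAt _ i)

  vertexAt≡tailAt : ∀ {x y} (w : W x y) i k → toℕ i ≡ toℕ k → vertexAt w i ≡ tailAt w k
  vertexAt≡tailAt (step _ _ w) zero    zero    _  = refl
  vertexAt≡tailAt (step _ _ w) (suc i) (suc k) eq = vertexAt≡tailAt w i k (ℕ.suc-injective eq)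

  vertexAt-target : ∀ {x y} (w : W x y) i → toℕ i ≡ wlength w → vertexAt w i ≡ y
  vertexAt-target []           zero    _  = refl
  vertexAt-target (step _ _ w) (suc i) eq = vertexAt-target w i (ℕ.suc-injective eq)

  walk⇒path : ∀ {x y} (w : W x y) → Unique (vertices w) → Path G x y
  walk⇒path w u = record
    { len = wlength w ; vtx = vertexAt w ; edg = edgeAt w ; start = refl ; finish = vertexAt-last w
    ; link = vertexAt-link w
    ; vtx-inj = λ i j → Unique-tabulate⇒injective (subst Unique (sym (tabulate-vertexAt w)) u) }

  onPath-walk⇒path : ∀ {x y h} (w : W x y) (u : Unique (vertices w)) → OnPath G h (walk⇒path w u) → h ∈ edges w
  onPath-walk⇒path w u (i , refl) = subst (edgeAt w i ∈_) (tabulate-edgeAt w) (∈-tabulate⁺ {f = edgeAt w} i)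

  module _ {x y} (P : Path G x y) where
    open Path P

    path⇒walk : W x y
    path⇒walk = castʷ start finish (fromIndexed len vtx edg link)

    Unique-vertices-path⇒walk : Unique (vertices path⇒walk)
    Unique-vertices-path⇒walk =
      subst Unique (sym (trans (vertices-castʷ start finish _) (vertices-fromIndexed len vtx edg link)))
        (Unique.tabulate⁺ (vtx-inj _ _))

    onPath-path⇒walk : ∀ {h} → h ∈ edges path⇒walk → OnPath G h P
    onPath-path⇒walk h∈
      with ∈-tabulate⁻ (subst (_ ∈_) (trans (edges-castʷ start finish _) (edges-fromIndexed len vtx edg link)) h∈)
    ... | i , h≡ = i , sym h≡

    vertex-path⇒walk : ∀ {z} → (∃ λ i → vtx i ≡ z) → z ∈ vertices path⇒walk
    vertex-path⇒walk (i , refl) =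
      subst (vtx i ∈_) (sym (trans (vertices-castʷ start finish _) (vertices-fromIndexed len vtx edg link)))
        (∈-tabulate⁺ {f = vtx} i)

  module _ (C : Cycle G) where
    open Cycle C

    private
      vtx⁺ : Fin (suc (suc len)) → V
      vtx⁺ zero    = vtx zero
      vtx⁺ (suc i) = vtx (csuc i)

      vtx⁺-inject₁ : (i : Fin (suc len)) → vtx⁺ (inject₁ i) ≡ vtx i
      vtx⁺-inject₁ zero    = refl
      vtx⁺-inject₁ (suc i) = cong vtx (csuc-inject₁ i)

      link⁺ : ∀ i → Joins G (edg i) (vtx⁺ (inject₁ i)) (vtx⁺ (suc i))
      link⁺ i = subst (λ t → Joins G (edg i) t (vtx (csuc i))) (sym (vtx⁺-inject₁ i)) (link i)

      closes : vtx⁺ (fromℕ (suc len)) ≡ vtx zero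
      closes = cong vtx (csuc-fromℕ len)

    cycle⇒walk : W (vtx zero) (vtx zero)
    cycle⇒walk = castʷ refl closes (fromIndexed (suc len) vtx⁺ edg link⁺)

    dart-cycle⇒walk : ∀ {f p q} → Dart cycle⇒walk f p q → ∃ λ i → edg i ≡ f × vtx i ≡ p × vtx (csuc i) ≡ q
    dart-cycle⇒walk d with dart-fromIndexed (suc len) vtx⁺ edg link⁺ (dart-castʷ refl closes _ d)
    ... | i , f≡ , p≡ , q≡ = i , f≡ , trans (sym (vtx⁺-inject₁ i)) p≡ , q≡

    Unique-tails-cycle⇒walk : Unique (tails cycle⇒walk)
    Unique-tails-cycle⇒walk =
      subst Unique (sym (trans (tails-castʷ refl closes _) (tails-fromIndexed (suc len) vtx⁺ edg link⁺)))
        (Unique.tabulate⁺ λ {i} {j} eq →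
          vtx-inj i j (trans (sym (vtx⁺-inject₁ i)) (trans eq (vtx⁺-inject₁ j))))

    Unique-edges-cycle⇒walk : Unique (edges cycle⇒walk)
    Unique-edges-cycle⇒walk =
      subst Unique (sym (trans (edges-castʷ refl closes _) (edges-fromIndexed (suc len) vtx⁺ edg link⁺)))
        (Unique.tabulate⁺ (edg-inj _ _))

    start∈tails-cycle⇒walk : vtx zero ∈ tails cycle⇒walk
    start∈tails-cycle⇒walk = subst (_ ∈_) (sym (tails-castʷ refl closes _)) (here refl)

  closing-link : ∀ {x z f} (j : Joins G f x z) (w₀ : W z x) (i : Fin (suc (wlength w₀))) →
                 vertexAt (step f j w₀) (suc i) ≡ tailAt (step f j w₀) (csuc i)
  closing-link j w₀ i with csuc-cases i
  ... | inj₁ eq             = vertexAt≡tailAt (step _ j w₀) (suc i) (csuc i) (sym eq)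
  ... | inj₂ (eq , csuc≡0) =
    trans (vertexAt-target (step _ j w₀) (suc i) (cong suc eq)) (cong (tailAt (step _ j w₀)) (sym csuc≡0))

  closedWalk⇒cycle : ∀ {x} (w : W x x) → 0 < wlength w → Unique (tails w) → Unique (edges w) → Cycle G
  closedWalk⇒cycle w@(step _ j w₀) _ uT uE = record
    { len = wlength w₀ ; vtx = tailAt w ; edg = edgeAt w
    ; vtx-inj = λ i j → Unique-tabulate⇒injective (subst Unique (sym (tabulate-tailAt w)) uT)
    ; edg-inj = λ i j → Unique-tabulate⇒injective (subst Unique (sym (tabulate-edgeAt w)) uE)
    ; link = λ i → subst (Joins G (edgeAt w i) (tailAt w i)) (closing-link j w₀ i) (dart-joins (dart-edgeAt w i)) }

  dart-closedWalk⇒cycle : ∀ {x} (w : W x x) nonempty uT uE → let open Cycle (closedWalk⇒cycle w nonempty uT uE) in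
                          ∀ i → Dart w (edg i) (vtx i) (vtx (csuc i))
  dart-closedWalk⇒cycle w@(step _ j w₀) _ _ _ i =
    subst (Dart w (edgeAt w i) (tailAt w i)) (closing-link j w₀ i) (dart-edgeAt w i)

  vertex∈tails-closedWalk⇒cycle : ∀ {x} (w : W x x) nonempty uT uE →
                                  ∀ i → Cycle.vtx (closedWalk⇒cycle w nonempty uT uE) i ∈ tails w
  vertex∈tails-closedWalk⇒cycle w@(step _ _ _) _ _ _ i =
    subst (tailAt w i ∈_) (tabulate-tailAt w) (∈-tabulate⁺ {f = tailAt w} i)

  internal⇒two-edges : ∀ {x y z} (w : W x y) → Unique (vertices w) → z ∈ vertices w → z ≢ x → z ≢ y →
    ∃ λ h₁ → ∃ λ h₂ → h₁ ≢ h₂ × h₁ ∈ edges w × h₂ ∈ edges w × Inc G z h₁ × Inc G z h₂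
  internal⇒two-edges []           _ (here z≡x) z≢x _ = ⊥-elim (z≢x z≡x)
  internal⇒two-edges (step _ _ _) _ (here z≡x) z≢x _ = ⊥-elim (z≢x z≡x)
  internal⇒two-edges {z = z} (step {y = y₁} f j w) (x∉ ∷ u) (there z∈) z≢x z≢y with decV z y₁
  internal⇒two-edges (step f j [])             _        _ _   z≢y | yes refl = ⊥-elim (z≢y refl)
  internal⇒two-edges (step f j (step g j′ w)) (x∉ ∷ u) _ z≢x _   | yes refl =
    f , g , f≢g , here refl , there (here refl) , joins⇒incʳ j , joins⇒incˡ j′
    where
    f≢g : f ≢ g
    f≢g refl with joins-ends j j′
    ... | inj₁ (x≡z , _) = z≢x (sym x≡z)
    ... | inj₂ (x≡z₂ , _) = All≢⇒∉ x∉ (subst (_∈ vertices (step g j′ w)) (sym x≡z₂) (there (source∈vertices w)))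
  ... | no z≢y₁ with internal⇒two-edges w u z∈ z≢y₁ z≢y
  ... | h₁ , h₂ , h₁≢h₂ , h₁∈ , h₂∈ , inc₁ , inc₂ =
    h₁ , h₂ , h₁≢h₂ , there h₁∈ , there h₂∈ , inc₁ , inc₂

  first-edge : ∀ {x y} (w : W x y) → x ≢ y → ∃ λ h → h ∈ edges w × Inc G x h
  first-edge []           x≢y = ⊥-elim (x≢y refl)
  first-edge (step f j w) _   = f , here refl , joins⇒incˡ j

  last-edge : ∀ {x y} (w : W x y) → x ≢ y → ∃ λ h → h ∈ edges w × Inc G y h
  last-edge []                         x≢y = ⊥-elim (x≢y refl)
  last-edge {y = y} (step {y = z} f j w) _ with decV z y
  ... | yes refl = f , here refl , joins⇒incʳ j
  ... | no z≢y with last-edge w z≢y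
  ... | h , h∈ , inc = h , there h∈ , inc

  -- The edge list need only be complete up to endpoints: for G − h an edge carries a
  -- proof of f ≢ h, which a list cannot enumerate.
  module Reachability (Vs : List V) (Vs-complete : ∀ x → x ∈ Vs) (Es : List E)
                      (Es-complete : ∀ f → ∃ λ f′ → f′ ∈ Es × ends f′ ≡ ends f) where

    Step : V → Set
    Step x = Σ E λ f → Σ V (Joins G f x)

    steps : (x : V) → List E → List (Step x)
    steps x [] = []
    steps x (f ∷ fs) with decV (proj₁ (ends f)) x | decV (proj₂ (ends f)) x
    ... | yes p | _     = (f , proj₂ (ends f) , inj₁ (cong (_, proj₂ (ends f)) p)) ∷ steps x fs
    ... | no _  | yes q = (f , proj₁ (ends f) , inj₂ (cong (proj₁ (ends f) ,_) q)) ∷ steps x fs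
    ... | no _  | no _  = steps x fs

    steps-complete : ∀ {x z f} fs → f ∈ fs → Joins G f x z → Any (λ s → proj₁ (proj₂ s) ≡ z) (steps x fs)
    steps-complete {x} (f ∷ fs) f∈ j with decV (proj₁ (ends f)) x | decV (proj₂ (ends f)) x | f∈
    ... | yes p | _     | here refl = here (joins-other-end (inj₁ (cong (_, proj₂ (ends f)) p)) j)
    ... | yes _ | _     | there f∈′ = there (steps-complete fs f∈′ j)
    ... | no _  | yes q | here refl = here (joins-other-end (inj₂ (cong (proj₁ (ends f) ,_) q)) j)
    ... | no _  | yes _ | there f∈′ = there (steps-complete fs f∈′ j)
    ... | no ¬p | no ¬q | here refl = ⊥-elim ([ ¬p , ¬q ]′ (joins⇒incˡ j))
    ... | no _  | no _  | there f∈′ = steps-complete fs f∈′ j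

    walksFrom : ℕ → (x : V) → List (Σ V (W x))
    extend : ℕ → (x : V) → Step x → List (Σ V (W x))
    walksFrom zero    x = (x , []) ∷ []
    walksFrom (suc n) x = (x , []) ∷ concatMap (extend n x) (steps x Es)
    extend n x (f , z , j) = map (λ (y , w) → y , step f j w) (walksFrom n z)

    walksFrom-complete : ∀ n {x y} (w : W x y) → wlength w ≤ n → Any (λ s → proj₁ s ≡ y) (walksFrom n x)
    walksFrom-complete zero    []           _ = here refl
    walksFrom-complete (suc n) []           _ = here refl
    walksFrom-complete (suc n) {x} {y} (step {y = z} f j w) (s≤s len≤n) with Es-complete f
    ... | f′ , f′∈ , ends≡ =
      there (AnyP.concatMap⁺ (extend n _) (Any.map extend-complete (steps-complete Es f′∈ (joins-resp-ends ends≡ j))))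
      where
      extend-complete : ∀ {s : Step x} → proj₁ (proj₂ s) ≡ z → Any (λ t → proj₁ t ≡ y) (extend n x s)
      extend-complete refl = AnyP.map⁺ (walksFrom-complete n w len≤n)

    walk? : ∀ x y → Dec (W x y)
    walk? x y with Any.any? (λ s → decV (proj₁ s) y) (walksFrom (length Vs) x)
    ... | yes found = let (_ , w) , y≡ = Any.satisfied found in yes (subst (W x) y≡ w)
    ... | no ¬found = no λ w → let (w′ , u) = loopErase w in ¬found (walksFrom-complete _ w′ (short w′ u))
      where
      short : ∀ {x y} (w : W x y) → Unique (vertices w) → wlength w ≤ length Vs
      short w u = ℕ.≤-trans (ℕ.n≤1+n _)
        (subst (_≤ length Vs) (length-vertices w) (Unique-⊆⇒length≤ u (λ {z} _ → Vs-complete z)))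

-- Deleting an edge

module EdgeDeletion (G : Graph) (h : Graph.E G) where
  open Graph G
  open Walks G
  module G∖h = Walks (deleteEdge G h)

  restrict : ∀ {x y} (w : W x y) → (∀ {g} → g ∈ edges w → g ≢ h) → G∖h.W x y
  restrict []           _     = []
  restrict (step f j w) avoid = step (f , avoid (here refl)) j (restrict w (avoid ∘ there))

  unrestrict : ∀ {x y} → G∖h.W x y → W x y
  unrestrict []           = []
  unrestrict (step f j w) = step (proj₁ f) j (unrestrict w)

  vertices-restrict : ∀ {x y} (w : W x y) (avoid : ∀ {g} → g ∈ edges w → g ≢ h) →
                      G∖h.vertices (restrict w avoid) ≡ vertices w
  vertices-restrict []           _     = refl
  vertices-restrict (step _ _ w) avoid = cong (_ ∷_) (vertices-restrict w (avoid ∘ there))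

  edges-restrict : ∀ {x y} (w : W x y) (avoid : ∀ {g} → g ∈ edges w → g ≢ h) →
                   map proj₁ (G∖h.edges (restrict w avoid)) ≡ edges w
  edges-restrict []           _     = refl
  edges-restrict (step f _ w) avoid = cong (f ∷_) (edges-restrict w (avoid ∘ there))

  unrestrict-avoids : ∀ {x y g} (w : G∖h.W x y) → g ∈ edges (unrestrict w) → g ≢ h
  unrestrict-avoids (step (_ , f≢h) _ _) (here refl) = f≢h
  unrestrict-avoids (step _ _ w)         (there g∈)  = unrestrict-avoids w g∈

  split-at-dart : ∀ {x y p q} {w : W x y} → Dart w h p q →
                  Σ (W x p) λ w₁ → Σ (W q y) λ w₂ → edges w ≡ edges w₁ ++ h ∷ edges w₂
  split-at-dart {w = step f j w} now       = [] , w , refl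
  split-at-dart {w = step f j w} (later d) with split-at-dart d
  ... | w₁ , w₂ , eq = step f j w₁ , w₂ , cong (f ∷_) eq

  detour⇒Connected : DecidableEquality E → Connected G → ∀ {p q} → Joins G h p q → G∖h.W p q →
                     Connected (deleteEdge G h)
  detour⇒Connected _≟_ connected jh detour s t = avoiding (connected s t)
    where
    bypass : ∀ {s t} → Joins G h s t → G∖h.W s t
    bypass j with joins-ends jh j
    ... | inj₁ (refl , refl) = detour
    ... | inj₂ (refl , refl) = G∖h.reverseʷ detour

    avoiding : ∀ {s t} → W s t → G∖h.W s t
    avoiding []          = []
    avoiding (step f j w) with f ≟ h
    ... | yes refl = bypass j G∖h.++ʷ avoiding w
    ... | no f≢h   = step (f , f≢h) j (avoiding w)

  closedTrail⇒Connected-deleteEdge : DecidableEquality E → Connected G →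
    ∀ {x} (w : W x x) → Unique (edges w) → h ∈ edges w → Connected (deleteEdge G h)
  closedTrail⇒Connected-deleteEdge _≟_ connected w uE h∈ with edge⇒dart w h∈
  ... | p , q , d with split-at-dart d
  ... | w₁ , w₂ , edges≡ = detour⇒Connected _≟_ connected (dart-joins d) (restrict rest avoids)
    where
    h∉ : h ∉ edges w₁ × h ∉ edges w₂
    h∉ = Unique-middle (edges w₁) (subst Unique edges≡ uE)

    rest : W p q
    rest = reverseʷ (w₂ ++ʷ w₁)

    avoids : ∀ {g} → g ∈ edges rest → g ≢ h
    avoids g∈ refl = [ proj₂ h∉ , proj₁ h∉ ]′ (∈-edges-++ʷ⁻ w₂ w₁ (∈-edges-reverseʷ (w₂ ++ʷ w₁) g∈))

-- Networks and embeddings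

module _ (G : Graph) where
  open Graph G

  incident-length≤3 : ∀ {w} {hs : List E} → Leaf G w ⊎ Deg3 G w → Unique hs → (∀ {h} → h ∈ hs → Inc G w h) →
                      length hs ≤ 3
  incident-length≤3 (inj₁ (g , _ , only-g)) u inc =
    ℕ.≤-trans (Unique-⊆⇒length≤ {ys = g ∷ []} u (λ h∈ → here (only-g _ (inc h∈)))) (s≤s z≤n)
  incident-length≤3 (inj₂ (g₁ , g₂ , g₃ , _ , _ , _ , _ , _ , _ , only)) u inc =
    Unique-⊆⇒length≤ {ys = g₁ ∷ g₂ ∷ g₃ ∷ []} u λ h∈ → case only _ (inc h∈) of λ where
      (inj₁ refl)        → here refl
      (inj₂ (inj₁ refl)) → there (here refl)
      (inj₂ (inj₂ refl)) → there (there (here refl))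

  network-decE : ∀ {X lab} → IsNetwork X G lab → DecidableEquality E
  network-decE nG f g with ≡-dec decV decV (ends f) (ends g)
    | ≡-dec decV decV (ends f) (proj₂ (ends g) , proj₁ (ends g))
  ... | yes p | _     = yes (IsNetwork.noParallel nG f g _ _ (inj₁ p) (inj₁ refl))
  ... | no _  | yes q = yes (IsNetwork.noParallel nG f g _ _ (inj₂ q) (inj₁ refl))
  ... | no ¬p | no _  = no λ { refl → ¬p refl }

  four-incident-edges : ∀ {w a b c d} → Leaf G w ⊎ Deg3 G w →
    Inc G w a → Inc G w b → Inc G w c → Inc G w d →
    a ≢ b → a ≢ c → a ≢ d → b ≢ c → b ≢ d → c ≢ d → ⊥
  four-incident-edges {w} {a} {b} {c} {d} deg ia ib ic id a≢b a≢c a≢d b≢c b≢d c≢d =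
    ℕ.<-irrefl refl (incident-length≤3 deg
      ((a≢b ∷ a≢c ∷ a≢d ∷ []) ∷ (b≢c ∷ b≢d ∷ []) ∷ (c≢d ∷ []) ∷ [] ∷ []) incident)
    where
    incident : ∀ {h} → h ∈ a ∷ b ∷ c ∷ d ∷ [] → Inc G w h
    incident (here refl)                         = ia
    incident (there (here refl))                 = ib
    incident (there (there (here refl)))         = ic
    incident (there (there (there (here refl)))) = id

-- Since every vertex of N has degree at most 3, the edge-disjointness of the paths
-- already rules out a path passing through the image of a tree vertex or two paths
-- meeting in an internal vertex.
module _ {X : Set} {T : Graph} {labT : X → Graph.V T} {N : Graph} {labN : X → Graph.V N}
         (nT : IsNetwork X T labT) (nN : IsNetwork X N labN) (ϕ : Embedding T labT N labN) where
  open Embedding ϕ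
  open Walks N
  private
    module T = Graph T
    module IT = IsNetwork nT
    module IN = IsNetwork nN

    walkOf : (f : T.E) → W (φ (proj₁ (T.ends f))) (φ (proj₂ (T.ends f)))
    walkOf f = path⇒walk (path f)

    distinct-ends : ∀ f → φ (proj₁ (T.ends f)) ≢ φ (proj₂ (T.ends f))
    distinct-ends f eq = IT.loopless f (φ-inj _ _ eq)

  edge-at-image : ∀ {a f} → Inc T a f → ∃ λ h → OnPath N h (path f) × Inc N (φ a) h
  edge-at-image {f = f} (inj₁ refl) with first-edge (walkOf f) (distinct-ends f)
  ... | h , h∈ , inc = h , onPath-path⇒walk (path f) h∈ , inc
  edge-at-image {f = f} (inj₂ refl) with last-edge (walkOf f) (distinct-ends f)
  ... | h , h∈ , inc = h , onPath-path⇒walk (path f) h∈ , inc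

  paths-edge-disjoint : ∀ {f g h h′} → f ≢ g → OnPath N h (path f) → OnPath N h′ (path g) → h ≢ h′
  paths-edge-disjoint f≢g on on′ refl = edgeDisj _ _ f≢g _ on on′

  private
    internal-edges : ∀ {f w} → Internal N w (path f) →
      ∃ λ h₁ → ∃ λ h₂ → h₁ ≢ h₂ × OnPath N h₁ (path f) × OnPath N h₂ (path f) × Inc N w h₁ × Inc N w h₂
    internal-edges {f} (w∈ , w≢x , w≢y)
      with internal⇒two-edges (walkOf f) (Unique-vertices-path⇒walk (path f)) (vertex-path⇒walk (path f) w∈) w≢x w≢y
    ... | h₁ , h₂ , h₁≢h₂ , h₁∈ , h₂∈ , i₁ , i₂ =
      h₁ , h₂ , h₁≢h₂ , onPath-path⇒walk (path f) h₁∈ , onPath-path⇒walk (path f) h₂∈ , i₁ , i₂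

    not-incident : ∀ {f f′ a} → Internal N (φ a) (path f) → Inc T a f′ → f ≢ f′
    not-incident (_ , ≢x , _) (inj₁ refl) refl = ≢x refl
    not-incident (_ , _ , ≢y) (inj₂ refl) refl = ≢y refl

    image-not-internal : ∀ f a → ¬ Internal N (φ a) (path f)
    image-not-internal f a int with internal-edges int | IT.degree a
    ... | h₁ , h₂ , h₁≢h₂ , _ , _ , i₁ , i₂ | inj₁ leaf with IT.leaf-lab a leaf
    ... | x , refl with IN.lab-leaf x
    ... | _ , _ , only = h₁≢h₂ (trans (only h₁ (subst (λ t → Inc N t h₁) (φ-leaf x) i₁))
                                      (sym (only h₂ (subst (λ t → Inc N t h₂) (φ-leaf x) i₂))))
    image-not-internal f a int
      | _ , _ , _ , on , _ , i , _ | inj₂ (f₁ , f₂ , f₃ , f₁≢f₂ , f₁≢f₃ , f₂≢f₃ , a₁ , a₂ , a₃ , _)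
      with edge-at-image a₁ | edge-at-image a₂ | edge-at-image a₃
    ... | _ , on₁ , i₁ | _ , on₂ , i₂ | _ , on₃ , i₃ =
      four-incident-edges N (IN.degree (φ a)) i i₁ i₂ i₃
        (paths-edge-disjoint (not-incident int a₁) on on₁) (paths-edge-disjoint (not-incident int a₂) on on₂)
        (paths-edge-disjoint (not-incident int a₃) on on₃)
        (paths-edge-disjoint f₁≢f₂ on₁ on₂) (paths-edge-disjoint f₁≢f₃ on₁ on₃)
        (paths-edge-disjoint f₂≢f₃ on₂ on₃)

    paths-internally-disjoint : ∀ f g → f ≢ g → ∀ w → Internal N w (path f) → Internal N w (path g) → ⊥
    paths-internally-disjoint f g f≢g w in-f in-g with internal-edges in-f | internal-edges in-g
    ... | h₁ , h₂ , h₁≢h₂ , on₁ , on₂ , i₁ , i₂ | k₁ , k₂ , k₁≢k₂ , on₁′ , on₂′ , j₁ , j₂ =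
      four-incident-edges N (IN.degree w) i₁ i₂ j₁ j₂ h₁≢h₂
        (paths-edge-disjoint f≢g on₁ on₁′) (paths-edge-disjoint f≢g on₁ on₂′)
        (paths-edge-disjoint f≢g on₂ on₁′) (paths-edge-disjoint f≢g on₂ on₂′) k₁≢k₂

  embedding⇒displays : Displays T labT N labN
  embedding⇒displays = ϕ , image-not-internal , paths-internally-disjoint

module _ {A : Set} {P : A → Set} (P? : ∀ a → Dec (P a)) where

  restrictList : List A → List (Σ A P)
  restrictList []       = []
  restrictList (a ∷ xs) with P? a
  ... | yes p = (a , p) ∷ restrictList xs
  ... | no _  = restrictList xs

  ∈-restrictList : ∀ {xs a} → a ∈ xs → P a → ∃ λ p → (a , p) ∈ restrictList xs
  ∈-restrictList {a′ ∷ _} a∈ p with P? a′ | a∈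
  ... | yes p′ | here refl = p′ , here refl
  ... | yes _  | there a∈′ = let p′ , a∈″ = ∈-restrictList a∈′ p in p′ , there a∈″
  ... | no ¬p  | here refl = ⊥-elim (¬p p)
  ... | no _   | there a∈′ = ∈-restrictList a∈′ p

  Finite-Σ : (∀ {a} (p q : P a) → p ≡ q) → Finite A → Finite (Σ A P)
  Finite-Σ P-irrelevant (xs , complete) = restrictList xs , λ (a , p) →
    let p′ , a∈ = ∈-restrictList (complete a) p in subst (λ p → (a , p) ∈ restrictList xs) (P-irrelevant p′ p) a∈

Finite-⊎ : ∀ {A B : Set} → Finite A → Finite B → Finite (A ⊎ B)
Finite-⊎ (xs , xs-complete) (ys , ys-complete) =
  map inj₁ xs ++ map inj₂ ys , λ where
    (inj₁ a) → ∈-++⁺ˡ (∈-map⁺ inj₁ (xs-complete a))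
    (inj₂ b) → ∈-++⁺ʳ (map inj₁ xs) (∈-map⁺ inj₂ (ys-complete b))

×-T-irrelevant : ∀ {b c} (p q : Bool.T b × Bool.T c) → p ≡ q
×-T-irrelevant (p , q) (p′ , q′) = cong₂ _,_ (T-irrelevant p p′) (T-irrelevant q q′)

Finite-Bool : Finite Bool
Finite-Bool = true ∷ false ∷ [] , λ where
  true  → here refl
  false → there (here refl)

-- Eliminating a non-cut-edge

module Elimination {X : Set} (U : Graph) (labU : X → Graph.V U) (nU : IsNetwork X U labU)
                   (cuttable : ThreeCuttable U) (e : Graph.E U) (e-not-cut : ¬ CutEdge U e)
                   (D : ElimData U e) where
  open Graph U
  open IsNetwork nU
  open ElimData D
  open Elim U labU nU e D
  open Walks U
  module W' = Walks U'

  _≟E_ : DecidableEquality E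
  _≟E_ = network-decE U nU

  -- The two ends of e are handled uniformly: side true is u with neighbours a, b
  -- (via fa, fb), side false is v with neighbours c, d (via gc, gd).
  hub : Bool → V
  hub true  = u
  hub false = v

  rim : Bool → Bool → V
  rim true  true  = a
  rim true  false = b
  rim false true  = c
  rim false false = d

  spoke : Bool → Bool → E
  spoke true  true  = fa
  spoke true  false = fb
  spoke false true  = gc
  spoke false false = gd

  spoke-joins : ∀ s o → Joins U (spoke s o) (hub s) (rim s o)
  spoke-joins true  true  = fa-j
  spoke-joins true  false = fb-j
  spoke-joins false true  = gc-j
  spoke-joins false false = gd-j

  e-joins : ∀ s → Joins U e (hub s) (hub (not s))
  e-joins true  = inj₁ refl
  e-joins false = inj₂ refl

  hub-edges : ∀ s g → Inc U (hub s) g → g ≡ e ⊎ ∃ λ o → g ≡ spoke s o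
  hub-edges true g inc with u-edges g inc
  ... | inj₁ g≡e         = inj₁ g≡e
  ... | inj₂ (inj₁ g≡fa) = inj₂ (true , g≡fa)
  ... | inj₂ (inj₂ g≡fb) = inj₂ (false , g≡fb)
  hub-edges false g inc with v-edges g inc
  ... | inj₁ g≡e         = inj₁ g≡e
  ... | inj₂ (inj₁ g≡gc) = inj₂ (true , g≡gc)
  ... | inj₂ (inj₂ g≡gd) = inj₂ (false , g≡gd)

  hubs-distinct : ∀ s → hub s ≢ hub (not s)
  hubs-distinct true  = loopless e
  hubs-distinct false = loopless e ∘ sym

  rim≢hub : ∀ s o s′ → rim s o ≢ hub s′
  rim≢hub true  true  true  = a≢u
  rim≢hub true  true  false = a≢v
  rim≢hub true  false true  = b≢u
  rim≢hub true  false false = b≢v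
  rim≢hub false true  true  = c≢u
  rim≢hub false true  false = c≢v
  rim≢hub false false true  = d≢u
  rim≢hub false false false = d≢v

  spokes-distinct : ∀ s → spoke s true ≢ spoke s false
  spokes-distinct true  = fa≢fb
  spokes-distinct false = gc≢gd

  spoke-at-hub : ∀ s o → Inc U (hub s) (spoke s o)
  spoke-at-hub s o = joins⇒incˡ (spoke-joins s o)

  spoke-side : ∀ {s o s′} → Inc U (hub s′) (spoke s o) → s′ ≡ s
  spoke-side {s} {o} {s′} inc with s′ Bool.≟ s
  ... | yes s′≡s = s′≡s
  ... | no s′≢s with inc⇒endpoint (spoke-joins s o) inc
  ...   | inj₁ hub≡ = ⊥-elim (hubs-distinct s (subst (λ t → hub s ≡ hub t) (¬-not s′≢s) (sym hub≡)))
  ...   | inj₂ hub≡ = ⊥-elim (rim≢hub s o s′ (sym hub≡))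

  spoke-injective : ∀ {s o s′ o′} → spoke s o ≡ spoke s′ o′ → s ≡ s′ × o ≡ o′
  spoke-injective {s} {o} {s′} {o′} eq with spoke-side {s′} {o′} {s} (subst (Inc U (hub s)) eq (spoke-at-hub s o))
  ... | refl with o | o′
  ...   | true  | true  = refl , refl
  ...   | false | false = refl , refl
  ...   | true  | false = ⊥-elim (spokes-distinct s eq)
  ...   | false | true  = ⊥-elim (spokes-distinct s (sym eq))

  rims-distinct : ∀ s o → rim s o ≢ rim s (not o)
  rims-distinct s o eq = not-¬ refl (proj₂ (spoke-injective {s} {o} {s} {not o}
    (noParallel _ _ _ _ (spoke-joins s o)
      (subst (Joins U (spoke s (not o)) (hub s)) (sym eq) (spoke-joins s (not o))))))

  same-or-flip : ∀ o o′ → o′ ≡ o ⊎ o′ ≡ not o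
  same-or-flip true  true  = inj₁ refl
  same-or-flip true  false = inj₂ refl
  same-or-flip false true  = inj₂ refl
  same-or-flip false false = inj₁ refl

  NotHub : V → Set
  NotHub w = ∀ s → w ≢ hub s

  kept : ∀ w → NotHub w → V'
  kept w nh = keep w (nh true) (nh false)

  notHub : (w′ : V') → NotHub (proj₁ w′)
  notHub (_ , p , _) true  = toWitnessFalse p
  notHub (_ , _ , q) false = toWitnessFalse q

  hub-or-notHub : ∀ w → (∃ λ s → w ≡ hub s) ⊎ NotHub w
  hub-or-notHub w with decV w u | decV w v
  ... | yes w≡u | _       = inj₁ (true , w≡u)
  ... | no _    | yes w≡v = inj₁ (false , w≡v)
  ... | no w≢u  | no w≢v  = inj₂ λ { true → w≢u ; false → w≢v }

  V'-ext : ∀ {p q : V'} → proj₁ p ≡ proj₁ q → p ≡ q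
  V'-ext {w , k} {.w , k′} refl = cong (w ,_) (×-T-irrelevant k k′)

  rim' : Bool → Bool → V'
  rim' s o = kept (rim s o) (rim≢hub s o)

  OffHubs : E → Set
  OffHubs h = ∀ s → ¬ Inc U (hub s) h

  old : (h : E) → OffHubs h → E'
  old h off = inj₁ (h , fromWitnessFalse (off true) , fromWitnessFalse (off false))

  old-ext : ∀ {h} {p p′ : False (incDec u h)} {q q′ : False (incDec v h)} →
            _≡_ {A = E'} (inj₁ (h , p , q)) (inj₁ (h , p′ , q′))
  old-ext {h} {p} {p′} {q} {q′} = cong (λ k → inj₁ (h , k)) (×-T-irrelevant (p , q) (p′ , q′))

  old-offHubs : ∀ {h} {p : False (incDec u h)} {q : False (incDec v h)} → OffHubs h
  old-offHubs {p = p} true  = toWitnessFalse p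
  old-offHubs {q = q} false = toWitnessFalse q

  old-joins : ∀ {h p q} {x′ y′ : V'} → Joins U' (inj₁ (h , p , q)) x′ y′ → Joins U h (proj₁ x′) (proj₁ y′)
  old-joins (inj₁ r) = inj₁ (cong (λ (x , y) → proj₁ x , proj₁ y) r)
  old-joins (inj₂ r) = inj₂ (cong (λ (x , y) → proj₁ x , proj₁ y) r)

  old-joins⁺ : ∀ {h x y} (off : OffHubs h) (nx : NotHub x) (ny : NotHub y) →
               Joins U h x y → Joins U' (old h off) (kept x nx) (kept y ny)
  old-joins⁺ off nx ny (inj₁ r) = inj₁ (cong₂ _,_ (V'-ext (cong proj₁ r)) (V'-ext (cong proj₂ r)))
  old-joins⁺ off nx ny (inj₂ r) = inj₂ (cong₂ _,_ (V'-ext (cong proj₁ r)) (V'-ext (cong proj₂ r)))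

  data NewJoins (s : Bool) (x′ y′ : V') : Set where
    via : ∀ o → x′ ≡ rim' s o → y′ ≡ rim' s (not o) → NewJoins s x′ y′

  new-joins : ∀ {s x′ y′} → Joins U' (inj₂ s) x′ y′ → NewJoins s x′ y′
  new-joins {true}  (inj₁ r) = via true  (sym (cong proj₁ r)) (sym (cong proj₂ r))
  new-joins {true}  (inj₂ r) = via false (sym (cong proj₂ r)) (sym (cong proj₁ r))
  new-joins {false} (inj₁ r) = via true  (sym (cong proj₁ r)) (sym (cong proj₂ r))
  new-joins {false} (inj₂ r) = via false (sym (cong proj₂ r)) (sym (cong proj₁ r))

  new-joins⁺ : ∀ s o → Joins U' (inj₂ s) (rim' s o) (rim' s (not o))
  new-joins⁺ true  true  = inj₁ refl
  new-joins⁺ true  false = inj₂ refl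
  new-joins⁺ false true  = inj₁ refl
  new-joins⁺ false false = inj₂ refl

  new-inc : ∀ {s} {w′ : V'} → Inc U' w′ (inj₂ s) → ∃ λ o → w′ ≡ rim' s o
  new-inc {true}  (inj₁ r) = true  , sym r
  new-inc {true}  (inj₂ r) = false , sym r
  new-inc {false} (inj₁ r) = true  , sym r
  new-inc {false} (inj₂ r) = false , sym r

  new-inc⁺ : ∀ s o → Inc U' (rim' s o) (inj₂ s)
  new-inc⁺ true  true  = inj₁ refl
  new-inc⁺ true  false = inj₂ refl
  new-inc⁺ false true  = inj₁ refl
  new-inc⁺ false false = inj₂ refl

  at-hub : ∀ s {w h} → NotHub w → Inc U w h → Inc U (hub s) h → ∃ λ o → h ≡ spoke s o × w ≡ rim s o
  at-hub s nw iw ih with hub-edges s _ ih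
  ... | inj₁ refl with inc⇒endpoint (e-joins s) iw
  ...   | inj₁ w≡ = ⊥-elim (nw s w≡)
  ...   | inj₂ w≡ = ⊥-elim (nw (not s) w≡)
  at-hub s nw iw ih | inj₂ (o , refl) with inc⇒endpoint (spoke-joins s o) iw
  ... | inj₁ w≡ = ⊥-elim (nw s w≡)
  ... | inj₂ w≡ = o , refl , w≡

  -- Each edge of U other than e becomes an edge of U': those at u (resp. v) become
  -- the new edge ab (resp. cd), the others are kept.
  data Kind (h : E) : Set where
    off-hubs : OffHubs h → Kind h
    at       : ∀ s → Inc U (hub s) h → Kind h

  kind : ∀ h → Kind h
  kind h with incDec u h | incDec v h
  ... | yes iu  | _       = at true iu
  ... | no _    | yes iv  = at false iv
  ... | no ¬iu  | no ¬iv  = off-hubs λ { true → ¬iu ; false → ¬iv }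

  fromKind : ∀ {h} → Kind h → E'
  fromKind {h} (off-hubs off) = old h off
  fromKind     (at s _)       = inj₂ s

  contractEdge : E → E'
  contractEdge h = fromKind (kind h)

  fromKind-old : ∀ {h p q} (κ : Kind h) → fromKind κ ≡ inj₁ (h , p , q)
  fromKind-old         (off-hubs _)   = old-ext
  fromKind-old {p = p} (at true inc)  = ⊥-elim (toWitnessFalse p inc)
  fromKind-old {q = q} (at false inc) = ⊥-elim (toWitnessFalse q inc)

  fromKind-spoke : ∀ s o (κ : Kind (spoke s o)) → fromKind κ ≡ inj₂ s
  fromKind-spoke s o (off-hubs off) = ⊥-elim (off s (spoke-at-hub s o))
  fromKind-spoke s o (at s′ inc)    = cong inj₂ (spoke-side inc)

  contractEdge-spoke : ∀ s o → contractEdge (spoke s o) ≡ inj₂ s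
  contractEdge-spoke s o = fromKind-spoke s o (kind (spoke s o))

  module AtKept (w′ : V') where
    private
      w  = proj₁ w′
      nw = notHub w′

    fromKind-inc : ∀ {h} (κ : Kind h) → Inc U w h → Inc U' w′ (fromKind κ)
    fromKind-inc (off-hubs _) (inj₁ r) = inj₁ (V'-ext r)
    fromKind-inc (off-hubs _) (inj₂ r) = inj₂ (V'-ext r)
    fromKind-inc (at s ih)    iw with at-hub s nw iw ih
    ... | o , _ , w≡ = subst (λ t → Inc U' t (inj₂ s)) (V'-ext (sym w≡)) (new-inc⁺ s o)

    contractEdge-inc : ∀ {h} → Inc U w h → Inc U' w′ (contractEdge h)
    contractEdge-inc = fromKind-inc (kind _)

    contractEdge-onto : ∀ {k} → Inc U' w′ k → ∃ λ h → Inc U w h × contractEdge h ≡ k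
    contractEdge-onto {inj₁ (h , _)} (inj₁ r) = h , inj₁ (cong proj₁ r) , fromKind-old (kind h)
    contractEdge-onto {inj₁ (h , _)} (inj₂ r) = h , inj₂ (cong proj₁ r) , fromKind-old (kind h)
    contractEdge-onto {inj₂ s}       inc with new-inc {s} inc
    ... | o , refl = spoke s o , joins⇒incʳ (spoke-joins s o) , contractEdge-spoke s o

    fromKind-injective : ∀ {h₁ h₂} (κ₁ : Kind h₁) (κ₂ : Kind h₂) → Inc U w h₁ → Inc U w h₂ →
                         fromKind κ₁ ≡ fromKind κ₂ → h₁ ≡ h₂
    fromKind-injective (off-hubs _) (off-hubs _) _ _ refl = refl
    fromKind-injective (at s ih₁) (at .s ih₂) iw₁ iw₂ refl
      with at-hub s nw iw₁ ih₁ | at-hub s nw iw₂ ih₂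
    ... | o₁ , refl , w≡₁ | o₂ , refl , w≡₂ with o₁ Bool.≟ o₂
    ...   | yes refl  = refl
    ...   | no o₁≢o₂ =
      ⊥-elim (rims-distinct s o₁ (trans (sym w≡₁) (subst (λ t → w ≡ rim s t) (¬-not (o₁≢o₂ ∘ sym)) w≡₂)))

    contractEdge-≢ : ∀ {h₁ h₂} → Inc U w h₁ → Inc U w h₂ → h₁ ≢ h₂ → contractEdge h₁ ≢ contractEdge h₂
    contractEdge-≢ iw₁ iw₂ h₁≢h₂ eq = h₁≢h₂ (fromKind-injective (kind _) (kind _) iw₁ iw₂ eq)

    leaf⁺ : Leaf U w → Leaf U' w′
    leaf⁺ (g , ig , only-g) = contractEdge g , contractEdge-inc ig ,
      λ k ik → let h , ih , h↦k = contractEdge-onto {k} ik in trans (sym h↦k) (cong contractEdge (only-g h ih))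

    deg3⁺ : Deg3 U w → Deg3 U' w′
    deg3⁺ (f₁ , f₂ , f₃ , f₁≢f₂ , f₁≢f₃ , f₂≢f₃ , i₁ , i₂ , i₃ , only) =
      contractEdge f₁ , contractEdge f₂ , contractEdge f₃ ,
      contractEdge-≢ i₁ i₂ f₁≢f₂ , contractEdge-≢ i₁ i₃ f₁≢f₃ , contractEdge-≢ i₂ i₃ f₂≢f₃ ,
      contractEdge-inc i₁ , contractEdge-inc i₂ , contractEdge-inc i₃ , only′
      where
      only′ : ∀ k → Inc U' w′ k → k ≡ contractEdge f₁ ⊎ k ≡ contractEdge f₂ ⊎ k ≡ contractEdge f₃
      only′ k ik with contractEdge-onto {k} ik
      ... | h , ih , refl with only h ih
      ...   | inj₁ refl        = inj₁ refl
      ...   | inj₂ (inj₁ refl) = inj₂ (inj₁ refl)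
      ...   | inj₂ (inj₂ refl) = inj₂ (inj₂ refl)

    leaf⁻ : Leaf U' w′ → Leaf U w
    leaf⁻ (g , _ , only-g) with degree w
    ... | inj₁ leaf = leaf
    ... | inj₂ (f₁ , f₂ , _ , f₁≢f₂ , _ , _ , i₁ , i₂ , _) =
      ⊥-elim (contractEdge-≢ i₁ i₂ f₁≢f₂
        (trans (only-g _ (contractEdge-inc i₁)) (sym (only-g _ (contractEdge-inc i₂)))))

    degree' : Leaf U' w′ ⊎ Deg3 U' w′
    degree' with degree w
    ... | inj₁ leaf = inj₁ (leaf⁺ leaf)
    ... | inj₂ deg3 = inj₂ (deg3⁺ deg3)

  finV' : Finite V'
  finV' = Finite-Σ (λ w → T? _ ×-dec T? _) ×-T-irrelevant finV

  finE' : Finite E'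
  finE' = Finite-⊎ (Finite-Σ (λ h → T? _ ×-dec T? _) ×-T-irrelevant finE) Finite-Bool

  closedTrail-noCut : ∀ {x h} (w : W x x) → Unique (edges w) → h ∈ edges w → ¬ CutEdge U h
  closedTrail-noCut w uE h∈ cut = cut (EdgeDeletion.closedTrail⇒Connected-deleteEdge U _ _≟E_ connected w uE h∈)

  hub-noCut : ∀ s {x} (w : W x x) → Unique (edges w) → (∀ o → spoke s o ∈ edges w) → ¬ IncCut U (hub s)
  hub-noCut s w uE spokes∈ (f , inc , cut) with hub-edges s f inc
  ... | inj₁ refl       = e-not-cut cut
  ... | inj₂ (o , refl) = closedTrail-noCut w uE (spokes∈ o) cut

  o≢not-o : ∀ {o} → o ≢ not o
  o≢not-o = not-¬ refl

  spokes-opposite : ∀ o o′ → spoke true o ≢ spoke false o′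
  spokes-opposite o o′ eq with spoke-injective {true} {o} {false} {o′} eq
  ... | () , _

  spokes-flip : ∀ s o → spoke s o ≢ spoke s (not o)
  spokes-flip s o eq = o≢not-o (proj₂ (spoke-injective {s} {o} {s} {not o} eq))

  -- A triangle or a square through a hub would be a cycle without three consecutive
  -- vertices incident to cut-edges, since neither hub is.
  no-triangle : ∀ s o {h} → Joins U h (rim s o) (rim s (not o)) → ¬ Inc U (hub s) h → ⊥
  no-triangle s o {h} j h-off = spoiled (cuttable (closedWalk⇒cycle w (s≤s z≤n) uT uE))
    where
    w : W (hub s) (hub s)
    w = step (spoke s o) (spoke-joins s o) (step h j (step (spoke s (not o)) (joins-sym (spoke-joins s (not o))) []))
    uT : Unique (tails w)
    uT = ((rim≢hub s o s ∘ sym) ∷ (rim≢hub s (not o) s ∘ sym) ∷ []) ∷ (rims-distinct s o ∷ []) ∷ [] ∷ []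
    uE : Unique (edges w)
    uE = ((λ { refl → h-off (spoke-at-hub s o) }) ∷ spokes-flip s o ∷ [])
       ∷ ((λ { refl → h-off (spoke-at-hub s (not o)) }) ∷ []) ∷ [] ∷ []
    hub-ok : ¬ IncCut U (hub s)
    hub-ok = hub-noCut s w uE λ o′ → case same-or-flip o o′ of λ where
      (inj₁ refl) → here refl
      (inj₂ refl) → there (there (here refl))
    spoiled : _ → ⊥
    spoiled (zero             , c , _ , _) = hub-ok c
    spoiled (suc zero         , _ , _ , c) = hub-ok c
    spoiled (suc (suc zero)   , _ , c , _) = hub-ok c

  no-square : ∀ o o′ → rim true o ≡ rim false o′ → rim true (not o) ≡ rim false (not o′) → ⊥
  no-square o o′ eq eq′ = spoiled (cuttable (closedWalk⇒cycle w (s≤s z≤n) uT uE))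
    where
    w : W u u
    w = step (spoke true o) (spoke-joins true o)
          (step (spoke false o′) (subst (λ t → Joins U _ t v) (sym eq) (joins-sym (spoke-joins false o′)))
          (step (spoke false (not o′)) (spoke-joins false (not o′))
          (step (spoke true (not o)) (subst (λ t → Joins U _ t u) eq′ (joins-sym (spoke-joins true (not o)))) [])))
    uT : Unique (tails w)
    uT = ((rim≢hub true o true ∘ sym) ∷ hubs-distinct true ∷ (rim≢hub false (not o′) true ∘ sym) ∷ [])
       ∷ (rim≢hub true o false ∷ (λ r → rims-distinct true o (trans r (sym eq′))) ∷ [])
       ∷ ((rim≢hub false (not o′) false ∘ sym) ∷ []) ∷ [] ∷ []
    uE : Unique (edges w)
    uE = (spokes-opposite o o′ ∷ spokes-opposite o (not o′) ∷ spokes-flip true o ∷ [])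
       ∷ (spokes-flip false o′ ∷ (spokes-opposite (not o) o′ ∘ sym) ∷ [])
       ∷ ((spokes-opposite (not o) (not o′) ∘ sym) ∷ []) ∷ [] ∷ []
    u-ok : ¬ IncCut U u
    u-ok = hub-noCut true w uE λ o″ → case same-or-flip o o″ of λ where
      (inj₁ refl) → here refl
      (inj₂ refl) → there (there (there (here refl)))
    v-ok : ¬ IncCut U v
    v-ok = hub-noCut false w uE λ o″ → case same-or-flip o′ o″ of λ where
      (inj₁ refl) → there (here refl)
      (inj₂ refl) → there (there (here refl))
    spoiled : _ → ⊥
    spoiled (zero                   , c , _ , _) = u-ok c
    spoiled (suc zero               , _ , c , _) = v-ok c
    spoiled (suc (suc zero)         , c , _ , _) = v-ok c
    spoiled (suc (suc (suc zero))   , _ , c , _) = u-ok c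

  old-new-clash : ∀ {h p q s} {x′ y′ : V'} → Joins U' (inj₁ (h , p , q)) x′ y′ → Joins U' (inj₂ s) x′ y′ → ⊥
  old-new-clash {h} {p} {q} {s} j j′ with new-joins {s} j′
  ... | via o refl refl = no-triangle s o (old-joins {h} {p} {q} j) (old-offHubs {h} {p} {q} s)

  new-new-clash : ∀ {x′ y′ : V'} → Joins U' (inj₂ true) x′ y′ → Joins U' (inj₂ false) x′ y′ → ⊥
  new-new-clash j j′ with new-joins {true} j | new-joins {false} j′
  ... | via o refl refl | via o′ x≡ y≡ = no-square o o′ (cong proj₁ x≡) (cong proj₁ y≡)

  loopless' : ∀ k → proj₁ (ends' k) ≢ proj₂ (ends' k)
  loopless' (inj₁ (h , _)) r = loopless h (cong proj₁ r)
  loopless' (inj₂ true)    r = rims-distinct true true (cong proj₁ r)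
  loopless' (inj₂ false)   r = rims-distinct false true (cong proj₁ r)

  noParallel' : ∀ f g x y → Joins U' f x y → Joins U' g x y → f ≡ g
  noParallel' (inj₁ (h , p , q)) (inj₁ (h′ , p′ , q′)) _ _ j j′
    with noParallel h h′ _ _ (old-joins {h} {p} {q} j) (old-joins {h′} {p′} {q′} j′)
  ... | refl = old-ext
  noParallel' (inj₁ (h , p , q)) (inj₂ s) _ _ j j′ = ⊥-elim (old-new-clash {h} {p} {q} {s} j j′)
  noParallel' (inj₂ s) (inj₁ (h , p , q)) _ _ j j′ = ⊥-elim (old-new-clash {h} {p} {q} {s} j′ j)
  noParallel' (inj₂ true)  (inj₂ true)  _ _ _ _  = refl
  noParallel' (inj₂ false) (inj₂ false) _ _ _ _  = refl
  noParallel' (inj₂ true)  (inj₂ false) _ _ j j′ = ⊥-elim (new-new-clash j j′)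
  noParallel' (inj₂ false) (inj₂ true)  _ _ j j′ = ⊥-elim (new-new-clash j′ j)

  -- Expanding walks of U'

  hub-injective : ∀ {s s′} → hub s ≡ hub s′ → s ≡ s′
  hub-injective {true}  {true}  _  = refl
  hub-injective {false} {false} _  = refl
  hub-injective {true}  {false} eq = ⊥-elim (hubs-distinct true eq)
  hub-injective {false} {true}  eq = ⊥-elim (hubs-distinct false eq)

  _underlies_ : E → E' → Set
  g underlies inj₁ (h , _) = g ≡ h
  g underlies inj₂ s       = ∃ λ o → g ≡ spoke s o

  underlies-unique : ∀ {g} k k′ → g underlies k → g underlies k′ → k ≡ k′
  underlies-unique (inj₁ _)           (inj₁ _)           refl       refl       = old-ext
  underlies-unique (inj₁ (h , p , q)) (inj₂ s)           refl       (o , refl) =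
    ⊥-elim (old-offHubs {h} {p} {q} s (spoke-at-hub s o))
  underlies-unique (inj₂ s)           (inj₁ (h , p , q)) (o , refl) refl       =
    ⊥-elim (old-offHubs {h} {p} {q} s (spoke-at-hub s o))
  underlies-unique (inj₂ s)           (inj₂ s′)          (o , refl) (o′ , eq)  = cong inj₂ (proj₁ (spoke-injective eq))

  underlying : ∀ k → ∃ (_underlies k)
  underlying (inj₁ (h , _)) = h , refl
  underlying (inj₂ s)       = spoke s true , true , refl

  underlies-fromKind : ∀ {g} → g ≢ e → (κ : Kind g) → g underlies fromKind κ
  underlies-fromKind g≢e (off-hubs _) = refl
  underlies-fromKind g≢e (at s inc) with hub-edges s _ inc
  ... | inj₁ g≡e      = ⊥-elim (g≢e g≡e)
  ... | inj₂ (o , g≡) = o , g≡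

  hubsOf : E' → List V
  hubsOf (inj₁ _) = []
  hubsOf (inj₂ s) = hub s ∷ []

  expandNew : ∀ {s x′ y′} → NewJoins s x′ y′ → W (proj₁ x′) (proj₁ y′)
  expandNew {s} (via o refl refl) =
    step (spoke s o) (joins-sym (spoke-joins s o)) (step (spoke s (not o)) (spoke-joins s (not o)) [])

  expandStep : ∀ {x′ y′} k → Joins U' k x′ y′ → W (proj₁ x′) (proj₁ y′)
  expandStep (inj₁ (h , p , q)) j = step h (old-joins {h} {p} {q} j) []
  expandStep (inj₂ s)           j = expandNew (new-joins {s} j)

  expand : ∀ {x′ y′} → W'.W x′ y′ → W (proj₁ x′) (proj₁ y′)
  expand []           = []
  expand (step k j w) = expandStep k j ++ʷ expand w

  module _ {s : Bool} {x′ y′ : V'} where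
    edges-expandNew⁻ : ∀ {g} (n : NewJoins s x′ y′) → g ∈ edges (expandNew n) → g underlies inj₂ s
    edges-expandNew⁻ (via o refl refl) (here refl)         = o , refl
    edges-expandNew⁻ (via o refl refl) (there (here refl)) = not o , refl

    edges-expandNew⁺ : ∀ {g} (n : NewJoins s x′ y′) → g underlies inj₂ s → g ∈ edges (expandNew n)
    edges-expandNew⁺ (via o refl refl) (o′ , refl) with same-or-flip o o′
    ... | inj₁ refl = here refl
    ... | inj₂ refl = there (here refl)

    Unique-edges-expandNew : (n : NewJoins s x′ y′) → Unique (edges (expandNew n))
    Unique-edges-expandNew (via o refl refl) = (spokes-flip s o ∷ []) ∷ [] ∷ []

    tails-expandNew : (n : NewJoins s x′ y′) → tails (expandNew n) ≡ proj₁ x′ ∷ hub s ∷ []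
    tails-expandNew (via o refl refl) = refl

    dart-expandNew : ∀ {h} (n : NewJoins s x′ y′) (p′ q′ : V') → Dart (expandNew n) h (proj₁ p′) (proj₁ q′) → ⊥
    dart-expandNew (via o refl refl) p′ q′ now               = notHub q′ s refl
    dart-expandNew (via o refl refl) p′ q′ (later now)       = notHub p′ s refl
    dart-expandNew (via o refl refl) p′ q′ (later (later ()))

  module _ {x′ y′ : V'} where
    edges-expandStep⁻ : ∀ {g} k (j : Joins U' k x′ y′) → g ∈ edges (expandStep k j) → g underlies k
    edges-expandStep⁻ (inj₁ _) j (here refl) = refl
    edges-expandStep⁻ (inj₂ s) j g∈          = edges-expandNew⁻ (new-joins {s} j) g∈

    edges-expandStep⁺ : ∀ {g} k (j : Joins U' k x′ y′) → g underlies k → g ∈ edges (expandStep k j)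
    edges-expandStep⁺ (inj₁ _) j refl = here refl
    edges-expandStep⁺ (inj₂ s) j g◁   = edges-expandNew⁺ (new-joins {s} j) g◁

    Unique-edges-expandStep : ∀ k (j : Joins U' k x′ y′) → Unique (edges (expandStep k j))
    Unique-edges-expandStep (inj₁ _) j = [] ∷ []
    Unique-edges-expandStep (inj₂ s) j = Unique-edges-expandNew (new-joins {s} j)

    tails-expandStep : ∀ k (j : Joins U' k x′ y′) → tails (expandStep k j) ≡ proj₁ x′ ∷ hubsOf k
    tails-expandStep (inj₁ _) j = refl
    tails-expandStep (inj₂ s) j = tails-expandNew (new-joins {s} j)

    dart-expandStep : ∀ {h} k (j : Joins U' k x′ y′) (p′ q′ : V') → Dart (expandStep k j) h (proj₁ p′) (proj₁ q′) →
                      p′ ≡ x′ × q′ ≡ y′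
    dart-expandStep (inj₁ _) j p′ q′ now = V'-ext refl , V'-ext refl
    dart-expandStep (inj₂ s) j p′ q′ d   = ⊥-elim (dart-expandNew (new-joins {s} j) p′ q′ d)

  ∈-hubsOf : ∀ {z} k → z ∈ hubsOf k → ∃ λ s → k ≡ inj₂ s × z ≡ hub s
  ∈-hubsOf (inj₂ s) (here z≡) = s , refl , z≡

  tails-expand-step : ∀ {x′ y′ z′} k (j : Joins U' k x′ y′) (w : W'.W y′ z′) →
                      tails (expand (step k j w)) ≡ proj₁ x′ ∷ hubsOf k ++ tails (expand w)
  tails-expand-step k j w =
    trans (tails-++ʷ (expandStep k j) (expand w)) (cong (_++ tails (expand w)) (tails-expandStep k j))

  ∈-edges-expand⁻ : ∀ {x′ y′ g} (w : W'.W x′ y′) → g ∈ edges (expand w) → ∃ λ k → k ∈ W'.edges w × g underlies k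
  ∈-edges-expand⁻ (step k j w) g∈ with ∈-edges-++ʷ⁻ (expandStep k j) (expand w) g∈
  ... | inj₁ g∈k = k , here refl , edges-expandStep⁻ k j g∈k
  ... | inj₂ g∈w = let k′ , k′∈ , g◁ = ∈-edges-expand⁻ w g∈w in k′ , there k′∈ , g◁

  ∈-edges-expand⁺ : ∀ {x′ y′ g k} (w : W'.W x′ y′) → k ∈ W'.edges w → g underlies k → g ∈ edges (expand w)
  ∈-edges-expand⁺ (step k j w) (here refl) g◁ = ∈-edges-++ʷ⁺ˡ (expandStep k j) (expand w) (edges-expandStep⁺ k j g◁)
  ∈-edges-expand⁺ (step k j w) (there k∈)  g◁ = ∈-edges-++ʷ⁺ʳ (expandStep k j) (expand w) (∈-edges-expand⁺ w k∈ g◁)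

  Unique-edges-expand : ∀ {x′ y′} (w : W'.W x′ y′) → Unique (W'.edges w) → Unique (edges (expand w))
  Unique-edges-expand []           _          = []
  Unique-edges-expand (step k j w) (k∉ ∷ uE) =
    subst Unique (sym (edges-++ʷ (expandStep k j) (expand w)))
      (Unique.++⁺ (Unique-edges-expandStep k j) (Unique-edges-expand w uE) disjoint)
    where
    disjoint : Disjoint (edges (expandStep k j)) (edges (expand w))
    disjoint (g∈k , g∈w) with ∈-edges-expand⁻ w g∈w
    ... | k′ , k′∈ , g◁k′ =
      All≢⇒∉ k∉ (subst (_∈ W'.edges w) (underlies-unique k′ k g◁k′ (edges-expandStep⁻ k j g∈k)) k′∈)

  ∈-tails-expand⁻ : ∀ {x′ y′ z} (w : W'.W x′ y′) → z ∈ tails (expand w) →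
                    (∃ λ z′ → z′ ∈ W'.tails w × z ≡ proj₁ z′) ⊎ (∃ λ s → z ≡ hub s × inj₂ s ∈ W'.edges w)
  ∈-tails-expand⁻ {x′} (step k j w) z∈ with subst (_ ∈_) (tails-expand-step k j w) z∈
  ... | here z≡ = inj₁ (x′ , here refl , z≡)
  ... | there z∈′ with ∈-++⁻ (hubsOf k) z∈′
  ...   | inj₁ z∈hubs with ∈-hubsOf k z∈hubs
  ...     | s , refl , z≡ = inj₂ (s , z≡ , here refl)
  ∈-tails-expand⁻ (step k j w) z∈ | there z∈′ | inj₂ z∈w with ∈-tails-expand⁻ w z∈w
  ...     | inj₁ (z′ , z′∈ , z≡) = inj₁ (z′ , there z′∈ , z≡)
  ...     | inj₂ (s , z≡ , s∈)   = inj₂ (s , z≡ , there s∈)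

  ∈-tails-expand⁺ : ∀ {x′ y′ z′} (w : W'.W x′ y′) → z′ ∈ W'.tails w → proj₁ z′ ∈ tails (expand w)
  ∈-tails-expand⁺ (step k j w) z′∈ = subst (_ ∈_) (sym (tails-expand-step k j w)) (lift z′∈)
    where
    lift : _ → _
    lift (here refl) = here refl
    lift (there z′∈w) = there (∈-++⁺ʳ (hubsOf k) (∈-tails-expand⁺ w z′∈w))

  kept∉tails-expand : ∀ {x′ y′ z′} (w : W'.W x′ y′) → z′ ∉ W'.tails w → proj₁ z′ ∉ tails (expand w)
  kept∉tails-expand {z′ = z′} w z′∉ z∈ with ∈-tails-expand⁻ w z∈
  ... | inj₁ (z″ , z″∈ , z≡) = z′∉ (subst (_∈ W'.tails w) (V'-ext (sym z≡)) z″∈)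
  ... | inj₂ (s , z≡ , _)    = notHub z′ s z≡

  Unique-tails-expand : ∀ {x′ y′} (w : W'.W x′ y′) → Unique (W'.tails w) → Unique (W'.edges w) →
                        Unique (tails (expand w))
  Unique-tails-expand []                   _          _          = []
  Unique-tails-expand {x′} (step k j w) (x∉ ∷ uT) (k∉ ∷ uE) =
    subst Unique (sym (tails-expand-step k j w))
      (∉⇒All≢ x-fresh ∷ Unique.++⁺ (hubs-unique k) (Unique-tails-expand w uT uE) disjoint)
    where
    hubs-unique : ∀ k → Unique (hubsOf k)
    hubs-unique (inj₁ _) = []
    hubs-unique (inj₂ _) = [] ∷ []
    x-fresh : proj₁ x′ ∉ hubsOf k ++ tails (expand w)
    x-fresh x∈ with ∈-++⁻ (hubsOf k) x∈
    ... | inj₁ x∈hubs = let s , _ , x≡ = ∈-hubsOf k x∈hubs in notHub x′ s x≡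
    ... | inj₂ x∈w    = kept∉tails-expand w (All≢⇒∉ x∉) x∈w
    disjoint : Disjoint (hubsOf k) (tails (expand w))
    disjoint (z∈ , z∈w) with ∈-hubsOf k z∈ | ∈-tails-expand⁻ w z∈w
    ... | s , _ , z≡ | inj₁ (z′ , _ , z≡′)   = notHub z′ s (trans (sym z≡′) z≡)
    ... | s , k≡ , z≡ | inj₂ (s′ , z≡′ , s′∈) =
      All≢⇒∉ k∉ (subst (_∈ W'.edges w) (trans (cong inj₂ (hub-injective (trans (sym z≡′) z≡))) (sym k≡)) s′∈)

  Unique-vertices-expand : ∀ {x′ y′} (w : W'.W x′ y′) → Unique (W'.vertices w) → Unique (vertices (expand w))
  Unique-vertices-expand w u =
    Unique-tails⇒Unique-vertices (expand w)
      (Unique-tails-expand w (W'.Unique-vertices⇒Unique-tails w u) (W'.Unique-vertices⇒Unique-edges w u))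
      (kept∉tails-expand w (W'.Unique-vertices⇒target∉tails w u))

  dart-expand : ∀ {x′ y′ h} (w : W'.W x′ y′) (p′ q′ : V') → Dart (expand w) h (proj₁ p′) (proj₁ q′) →
                ∃ λ k → W'.Dart w k p′ q′
  dart-expand (step k j w) p′ q′ d with dart-++ʷ (expandStep k j) (expand w) d
  ... | inj₁ d₁ with dart-expandStep k j p′ q′ d₁
  ...   | refl , refl = k , W'.now
  dart-expand (step k j w) p′ q′ d | inj₂ d₂ = let k′ , d′ = dart-expand w p′ q′ d₂ in k′ , W'.later d′

  Displays-U'⇒Displays-U : ∀ {T labT} → IsNetwork X T labT → Displays T labT U' lab' → Displays T labT U labU
  Displays-U'⇒Displays-U {T} {labT} nT (ϕ′ , _) = embedding⇒displays nT nU ϕ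
    where
    open Embedding ϕ′

    walkOf : ∀ f → W (proj₁ (φ (proj₁ (Graph.ends T f)))) (proj₁ (φ (proj₂ (Graph.ends T f))))
    walkOf f = expand (W'.path⇒walk (path f))

    Unique-walkOf : ∀ f → Unique (vertices (walkOf f))
    Unique-walkOf f = Unique-vertices-expand _ (W'.Unique-vertices-path⇒walk (path f))

    disjoint : ∀ f g → f ≢ g → ∀ h → OnPath U h (walk⇒path (walkOf f) (Unique-walkOf f)) →
               OnPath U h (walk⇒path (walkOf g) (Unique-walkOf g)) → ⊥
    disjoint f g f≢g h on-f on-g
      with ∈-edges-expand⁻ (W'.path⇒walk (path f)) (onPath-walk⇒path (walkOf f) (Unique-walkOf f) on-f)
         | ∈-edges-expand⁻ (W'.path⇒walk (path g)) (onPath-walk⇒path (walkOf g) (Unique-walkOf g) on-g)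
    ... | k , k∈f , h◁k | k′ , k′∈g , h◁k′ with underlies-unique k k′ h◁k h◁k′
    ... | refl = edgeDisj f g f≢g k (W'.onPath-path⇒walk (path f) k∈f) (W'.onPath-path⇒walk (path g) k′∈g)

    ϕ : Embedding T labT U labU
    ϕ = record
      { φ        = proj₁ ∘ φ
      ; φ-inj    = λ a b eq → φ-inj a b (V'-ext eq)
      ; φ-leaf   = cong proj₁ ∘ φ-leaf
      ; path     = λ f → walk⇒path (walkOf f) (Unique-walkOf f)
      ; edgeDisj = disjoint }

  -- Contracting walks of U − e

  module U∖e = Walks (deleteEdge U e)
  open EdgeDeletion U e using (restrict; unrestrict; vertices-restrict; edges-restrict; unrestrict-avoids)

  data StepView (x z : V) (f : E) : Set where
    to-kept : NotHub z → OffHubs f → StepView x z f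
    to-hub  : ∀ s o → z ≡ hub s → f ≡ spoke s o → x ≡ rim s o → StepView x z f

  stepView : ∀ {x z f} → f ≢ e → Joins U f x z → NotHub x → StepView x z f
  stepView {z = z} {f} f≢e j nx with hub-or-notHub z
  ... | inj₁ (s , refl) with hub-edges s f (joins⇒incʳ j)
  ...   | inj₁ f≡e        = ⊥-elim (f≢e f≡e)
  ...   | inj₂ (o , refl) with joins-ends j (spoke-joins s o)
  ...     | inj₁ (x≡ , _) = ⊥-elim (nx s x≡)
  ...     | inj₂ (x≡ , _) = to-hub s o refl refl x≡
  stepView {z = z} {f} f≢e j nx | inj₂ nz = to-kept nz off
    where
    off : OffHubs f
    off s inc with inc⇒endpoint j inc
    ... | inj₁ hub≡x = nx s (sym hub≡x)
    ... | inj₂ hub≡z = nz s (sym hub≡z)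

  leaving-hub : ∀ s {z g} → g ≢ e → Joins U g (hub s) z → ∃ λ o → g ≡ spoke s o × z ≡ rim s o
  leaving-hub s g≢e j with hub-edges s _ (joins⇒incˡ j)
  ... | inj₁ g≡e        = ⊥-elim (g≢e g≡e)
  ... | inj₂ (o , refl) = o , refl , joins-other-end j (spoke-joins s o)

  hop : ∀ {y′} s o o′ → W'.W (rim' s o′) y′ → W'.W (rim' s o) y′
  hop s true  true  w = w
  hop s false false w = w
  hop s true  false w = step (inj₂ s) (new-joins⁺ s true) w
  hop s false true  w = step (inj₂ s) (new-joins⁺ s false) w

  -- A walk of U − e between vertices other than u, v contracts to a U'-walk: a passage
  -- a u b becomes the new edge ab, and a passage a u a is dropped.
  contract : ∀ {x y} (nx : NotHub x) (ny : NotHub y) → U∖e.W x y → W'.W (kept x nx) (kept y ny)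
  contractFromHub : ∀ {y} s o (ny : NotHub y) → U∖e.W (hub s) y → W'.W (rim' s o) (kept y ny)

  contract nx ny [] = W'.castʷ refl (V'-ext refl) []
  contract nx ny (step (f , f≢e) j w) with stepView f≢e j nx
  ... | to-kept nz off           = step (old f off) (old-joins⁺ off nx nz j) (contract nz ny w)
  ... | to-hub s o refl refl refl = W'.castʷ (V'-ext refl) refl (contractFromHub s o ny w)

  contractFromHub s o ny [] = ⊥-elim (ny s refl)
  contractFromHub s o ny (step (g , g≢e) j w) with leaving-hub s g≢e j
  ... | o′ , refl , refl = hop s o o′ (contract (rim≢hub s o′) ny w)

  keptVertices : ∀ {x′ y′} → W'.W x′ y′ → List V
  keptVertices w = map proj₁ (W'.vertices w)

  hop-⊆ : ∀ {y′} s o o′ (w : W'.W (rim' s o′) y′) {L} → keptVertices w ⊆ L →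
          keptVertices (hop s o o′ w) ⊆ rim s o ∷ hub s ∷ L
  hop-⊆ s true  true  w sub = _ ∷ʳ _ ∷ʳ sub
  hop-⊆ s false false w sub = _ ∷ʳ _ ∷ʳ sub
  hop-⊆ s true  false w sub = refl ∷ _ ∷ʳ sub
  hop-⊆ s false true  w sub = refl ∷ _ ∷ʳ sub

  contract-⊆ : ∀ {x y} nx ny (w : U∖e.W x y) → keptVertices (contract nx ny w) ⊆ U∖e.vertices w
  contractFromHub-⊆ : ∀ {y} s o ny (w : U∖e.W (hub s) y) →
                      keptVertices (contractFromHub s o ny w) ⊆ rim s o ∷ U∖e.vertices w

  contract-⊆ nx ny [] = subst (_⊆ _) (sym (cong (map proj₁) (W'.vertices-castʷ refl (V'-ext refl) []))) (refl ∷ [])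
  contract-⊆ nx ny (step (f , f≢e) j w) with stepView f≢e j nx
  ... | to-kept nz off            = refl ∷ contract-⊆ nz ny w
  ... | to-hub s o refl refl refl =
    subst (_⊆ _) (sym (cong (map proj₁) (W'.vertices-castʷ (V'-ext refl) refl _))) (contractFromHub-⊆ s o ny w)

  contractFromHub-⊆ s o ny [] = ⊥-elim (ny s refl)
  contractFromHub-⊆ s o ny (step (g , g≢e) j w) with leaving-hub s g≢e j
  ... | o′ , refl , refl = hop-⊆ s o o′ _ (contract-⊆ (rim≢hub s o′) ny w)

  Covered : List E → E' → Set
  Covered L k = ∀ {g} → g underlies k → g ∈ L

  spoke∈ : ∀ s o o′ {L} → spoke s o′ ∈ spoke s o ∷ spoke s (not o) ∷ L
  spoke∈ s o o′ with same-or-flip o o′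
  ... | inj₁ refl = here refl
  ... | inj₂ refl = there (here refl)

  hop-covered : ∀ {y′} s o o′ (w : W'.W (rim' s o′) y′) {L} → (∀ {k} → k ∈ W'.edges w → Covered L k) →
                ∀ {k} → k ∈ W'.edges (hop s o o′ w) → Covered (spoke s o ∷ spoke s o′ ∷ L) k
  hop-covered s true  true  w cov k∈ g◁ = there (there (cov k∈ g◁))
  hop-covered s false false w cov k∈ g◁ = there (there (cov k∈ g◁))
  hop-covered s true  false w cov (here refl) (o″ , refl) = spoke∈ s true o″
  hop-covered s false true  w cov (here refl) (o″ , refl) = spoke∈ s false o″
  hop-covered s true  false w cov (there k∈)  g◁ = there (there (cov k∈ g◁))
  hop-covered s false true  w cov (there k∈)  g◁ = there (there (cov k∈ g◁))

  contract-covered : ∀ {x y} nx ny (w : U∖e.W x y) {k} → k ∈ W'.edges (contract nx ny w) →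
                     Covered (map proj₁ (U∖e.edges w)) k
  contractFromHub-covered : ∀ {y} s o ny (w : U∖e.W (hub s) y) {k} → k ∈ W'.edges (contractFromHub s o ny w) →
                            Covered (spoke s o ∷ map proj₁ (U∖e.edges w)) k

  contract-covered nx ny [] k∈ with subst (_ ∈_) (W'.edges-castʷ refl (V'-ext refl) []) k∈
  ... | ()
  contract-covered nx ny (step (f , f≢e) j w) k∈ with stepView f≢e j nx
  contract-covered nx ny (step (f , f≢e) j w) (here refl) | to-kept nz off = λ { refl → here refl }
  contract-covered nx ny (step (f , f≢e) j w) (there k∈) | to-kept nz off = there ∘ contract-covered nz ny w k∈
  contract-covered nx ny (step (f , f≢e) j w) k∈ | to-hub s o refl refl refl =
    contractFromHub-covered s o ny w (subst (_ ∈_) (W'.edges-castʷ (V'-ext refl) refl _) k∈)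

  contractFromHub-covered s o ny [] k∈ = ⊥-elim (ny s refl)
  contractFromHub-covered s o ny (step (g , g≢e) j w) k∈ with leaving-hub s g≢e j
  ... | o′ , refl , refl = hop-covered s o o′ _ (contract-covered (rim≢hub s o′) ny w) k∈

  U∖e-connected : Connected (deleteEdge U e)
  U∖e-connected = EdgeDeletion.detour⇒Connected U e _≟E_ connected (e-joins true) u-to-v
    where
    edges∖e : List (Σ E (_≢ e))
    edges∖e = restrictList (λ f → ¬? (f ≟E e)) (proj₁ finE)

    edges∖e-complete : ∀ (f : Σ E (_≢ e)) → ∃ λ f′ → f′ ∈ edges∖e × ends (proj₁ f′) ≡ ends (proj₁ f)
    edges∖e-complete (f , f≢e) =
      let p , f∈ = ∈-restrictList (λ f → ¬? (f ≟E e)) (proj₂ finE f) f≢e in (f , p) , f∈ , refl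

    open U∖e.Reachability (proj₁ finV) (proj₂ finV) edges∖e edges∖e-complete using (walk?)

    u-to-v : U∖e.W u v
    u-to-v = decidable-stable (walk? u v) λ ¬w → e-not-cut λ conn → ¬w (conn u v)

  connected' : Connected U'
  connected' x′ y′ = W'.castʷ (V'-ext refl) (V'-ext refl)
    (contract (notHub x′) (notHub y′) (U∖e-connected (proj₁ x′) (proj₁ y′)))

  network' : IsNetwork X U' lab'
  network' = record
    { finV       = finV'
    ; finE       = finE'
    ; loopless   = loopless'
    ; noParallel = noParallel'
    ; connected  = connected'
    ; degree     = AtKept.degree'
    ; lab-inj    = λ x y eq → lab-inj x y (cong proj₁ eq)
    ; lab-leaf   = λ x → AtKept.leaf⁺ (lab' x) (lab-leaf x)
    ; leaf-lab   = λ w′ leaf → let x , eq = leaf-lab (proj₁ w′) (AtKept.leaf⁻ w′ leaf) in x , V'-ext eq }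

  label-notHub : ∀ x → NotHub (labU x)
  label-notHub x true  = leaf≢u x
  label-notHub x false = leaf≢v x

  Displays-U⇒Displays-U' : ∀ {T labT} → IsNetwork X T labT → (ϕ : Embedding T labT U labU) →
                           (∀ f → ¬ OnPath U e (Embedding.path ϕ f)) → Displays T labT U' lab'
  Displays-U⇒Displays-U' {T} {labT} nT ϕ avoids = embedding⇒displays nT network' ϕ′
    where
    open Embedding ϕ
    module IT = IsNetwork nT

    spoke-on-path : ∀ s {g f} → OnPath U g (path f) → Inc U (hub s) g → g ∈ spoke s true ∷ spoke s false ∷ []
    spoke-on-path s {f = f} on inc with hub-edges s _ inc
    ... | inj₁ refl       = ⊥-elim (avoids f on)
    ... | inj₂ (o , refl) = spoke∈ s true o

    image-notHub : ∀ a → NotHub (φ a)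
    image-notHub a s φa≡ with IT.degree a
    ... | inj₁ leaf = let x , a≡ = IT.leaf-lab a leaf in
      label-notHub x s (trans (sym (φ-leaf x)) (trans (cong φ a≡) φa≡))
    ... | inj₂ (f₁ , f₂ , f₃ , f₁≢f₂ , f₁≢f₃ , f₂≢f₃ , a₁ , a₂ , a₃ , _)
      with edge-at-image nT nU ϕ a₁ | edge-at-image nT nU ϕ a₂ | edge-at-image nT nU ϕ a₃
    ... | g₁ , on₁ , i₁ | g₂ , on₂ , i₂ | g₃ , on₃ , i₃ =
      ℕ.<-irrefl refl (Unique-⊆⇒length≤ {xs = g₁ ∷ g₂ ∷ g₃ ∷ []}
        ((apart f₁≢f₂ on₁ on₂ ∷ apart f₁≢f₃ on₁ on₃ ∷ []) ∷ (apart f₂≢f₃ on₂ on₃ ∷ []) ∷ [] ∷ [])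
        λ where
          (here refl)                 → spoke-on-path s on₁ (subst (λ t → Inc U t g₁) φa≡ i₁)
          (there (here refl))         → spoke-on-path s on₂ (subst (λ t → Inc U t g₂) φa≡ i₂)
          (there (there (here refl))) → spoke-on-path s on₃ (subst (λ t → Inc U t g₃) φa≡ i₃))
      where apart = paths-edge-disjoint nT nU ϕ

    walkOf : ∀ f → W (φ (proj₁ (Graph.ends T f))) (φ (proj₂ (Graph.ends T f)))
    walkOf f = path⇒walk (path f)

    avoids-e : ∀ f {g} → g ∈ edges (walkOf f) → g ≢ e
    avoids-e f g∈ refl = avoids f (onPath-path⇒walk (path f) g∈)

    φ′ : Graph.V T → V'
    φ′ a = kept (φ a) (image-notHub a)

    walkOf′ : ∀ f → W'.W (φ′ (proj₁ (Graph.ends T f))) (φ′ (proj₂ (Graph.ends T f)))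
    walkOf′ f = contract (image-notHub _) (image-notHub _) (restrict (walkOf f) (avoids-e f))

    Unique-walkOf′ : ∀ f → Unique (W'.vertices (walkOf′ f))
    Unique-walkOf′ f = Unique.map⁻ (Unique-resp-⊇ (contract-⊆ _ _ _)
      (subst Unique (sym (vertices-restrict (walkOf f) (avoids-e f))) (Unique-vertices-path⇒walk (path f))))

    on-path : ∀ f {k g} → OnPath U' k (W'.walk⇒path (walkOf′ f) (Unique-walkOf′ f)) → g underlies k →
              OnPath U g (path f)
    on-path f {g = g} on g◁ = onPath-path⇒walk (path f)
      (subst (g ∈_) (edges-restrict (walkOf f) (avoids-e f))
        (contract-covered _ _ (restrict (walkOf f) (avoids-e f))
          (W'.onPath-walk⇒path (walkOf′ f) (Unique-walkOf′ f) on) g◁))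

    ϕ′ : Embedding T labT U' lab'
    ϕ′ = record
      { φ        = φ′
      ; φ-inj    = λ a b eq → φ-inj a b (cong proj₁ eq)
      ; φ-leaf   = λ x → V'-ext (φ-leaf x)
      ; path     = λ f → W'.walk⇒path (walkOf′ f) (Unique-walkOf′ f)
      ; edgeDisj = λ f g f≢g k on-f on-g → let h , h◁k = underlying k in
                     edgeDisj f g f≢g h (on-path f on-f h◁k) (on-path g on-g h◁k) }

  off-hub-walk : ∀ g x → ∃ λ x′ → Σ (W x (proj₁ x′)) λ w → g ∉ edges w
  off-hub-walk g x with hub-or-notHub x
  ... | inj₂ nx         = kept x nx , [] , λ ()
  ... | inj₁ (s , refl) with g ≟E spoke s true
  ...   | yes g≡ = rim' s false , step (spoke s false) (spoke-joins s false) [] ,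
                   λ { (here g≡′) → spokes-distinct s (trans (sym g≡) g≡′) }
  ...   | no g≢  = rim' s true , step (spoke s true) (spoke-joins s true) [] , λ { (here g≡) → g≢ g≡ }

  Connected-deleteEdge-lift : ∀ k {g} → g underlies k → Connected (deleteEdge U' k) → Connected (deleteEdge U g)
  Connected-deleteEdge-lift k {g} g◁k connected′ x y = EdgeDeletion.restrict U g full avoids
    where
    open EdgeDeletion U' k using () renaming (unrestrict to unrestrict'; unrestrict-avoids to unrestrict-avoids')
    x′ = proj₁ (off-hub-walk g x)
    y′ = proj₁ (off-hub-walk g y)
    to-x′ = proj₁ (proj₂ (off-hub-walk g x))
    to-y′ = proj₁ (proj₂ (off-hub-walk g y))
    middle = expand (unrestrict' (connected′ x′ y′))
    full = to-x′ ++ʷ middle ++ʷ reverseʷ to-y′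

    middle-avoids : g ∉ edges middle
    middle-avoids g∈ with ∈-edges-expand⁻ _ g∈
    ... | k′ , k′∈ , g◁k′ = unrestrict-avoids' (connected′ x′ y′) k′∈ (underlies-unique k′ k g◁k′ g◁k)

    avoids : ∀ {g′} → g′ ∈ edges full → g′ ≢ g
    avoids g∈ refl with ∈-edges-++ʷ⁻ to-x′ _ g∈
    ... | inj₁ g∈x = proj₂ (proj₂ (off-hub-walk g x)) g∈x
    ... | inj₂ g∈rest with ∈-edges-++ʷ⁻ middle _ g∈rest
    ...   | inj₁ g∈m = middle-avoids g∈m
    ...   | inj₂ g∈y = proj₂ (proj₂ (off-hub-walk g y)) (∈-edges-reverseʷ to-y′ g∈y)

  IncCut⁺ : (p′ : V') → IncCut U (proj₁ p′) → IncCut U' p′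
  IncCut⁺ p′ (f , inc , cut) =
    contractEdge f , AtKept.contractEdge-inc p′ inc ,
    λ connected′ → cut (Connected-deleteEdge-lift _ (underlies-fromKind f≢e (kind f)) connected′)
    where
    f≢e : f ≢ e
    f≢e refl with inc⇒endpoint (e-joins true) inc
    ... | inj₁ p≡ = notHub p′ true p≡
    ... | inj₂ p≡ = notHub p′ false p≡

  -- A cycle of U' expands to a cycle of U; three consecutive cut-incident vertices of
  -- the latter cannot be hubs, so they are consecutive vertices of the former.
  module ExpandedCycle {x′} (w′ : W'.W x′ x′) (uT′ : Unique (W'.tails w′)) (uE′ : Unique (W'.edges w′))
                       (nonempty : 0 < wlength (expand w′)) where
    private
      uT = Unique-tails-expand w′ uT′ uE′
      uE = Unique-edges-expand w′ uE′

    C : Cycle U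
    C = closedWalk⇒cycle (expand w′) nonempty uT uE
    open Cycle C

    cut-vertex-notHub : ∀ i → IncCut U (vtx i) → NotHub (vtx i)
    cut-vertex-notHub i c s z≡ with ∈-tails-expand⁻ w′ (vertex∈tails-closedWalk⇒cycle (expand w′) nonempty uT uE i)
    ... | inj₁ (z′ , _ , z≡′)     = notHub z′ s (trans (sym z≡′) z≡)
    ... | inj₂ (s′ , z≡′ , s′∈) with hub-injective {s′} {s} (trans (sym z≡′) z≡)
    ...   | refl = hub-noCut s (expand w′) uE (λ o → ∈-edges-expand⁺ w′ s′∈ (o , refl)) (subst (IncCut U) z≡ c)

    keptAt : ∀ i → IncCut U (vtx i) → V'
    keptAt i c = kept (vtx i) (cut-vertex-notHub i c)

    consecutive : ∀ i c c′ → ∃ λ k → W'.Dart w′ k (keptAt i c) (keptAt (csuc i) c′)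
    consecutive i c c′ =
      dart-expand w′ (keptAt i c) (keptAt (csuc i) c′) (dart-closedWalk⇒cycle (expand w′) nonempty uT uE i)

  cuttable' : ThreeCuttable U'
  cuttable' C′ = three-consecutive (cuttable C)
    where
    module C′ = Cycle C′
    w′ = W'.cycle⇒walk C′
    open ExpandedCycle w′ (W'.Unique-tails-cycle⇒walk C′) (W'.Unique-edges-cycle⇒walk C′)
                       (∈-tails⇒nonempty (expand w′) (∈-tails-expand⁺ w′ (W'.start∈tails-cycle⇒walk C′)))
    open Cycle C

    on-C′ : ∀ i c c′ → ∃ λ j → C′.vtx j ≡ keptAt i c × C′.vtx (csuc j) ≡ keptAt (csuc i) c′
    on-C′ i c c′ = let j , _ , p≡ , q≡ = W'.dart-cycle⇒walk C′ (proj₂ (consecutive i c c′)) in j , p≡ , q≡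

    three-consecutive :
      (Σ _ λ i → IncCut U (vtx i) × IncCut U (vtx (csuc i)) × IncCut U (vtx (csuc (csuc i)))) →
      Σ _ λ j → IncCut U' (C′.vtx j) × IncCut U' (C′.vtx (csuc j)) × IncCut U' (C′.vtx (csuc (csuc j)))
    three-consecutive (i , c₀ , c₁ , c₂) =
      let j , r₀ , r₁ = on-C′ i c₀ c₁
          j′ , s₁ , s₂ = on-C′ (csuc i) c₁ c₂
      in j , subst (IncCut U') (sym r₀) (IncCut⁺ (keptAt i c₀) c₀)
           , subst (IncCut U') (sym r₁) (IncCut⁺ (keptAt (csuc i) c₁) c₁)
           , subst (λ t → IncCut U' (C′.vtx (csuc t))) (C′.vtx-inj j′ (csuc j) (trans s₁ (sym r₁)))
               (subst (IncCut U') (sym s₂) (IncCut⁺ (keptAt (csuc (csuc i)) c₂) c₂))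

lemma11 : {X : Set} (T : Graph) (labT : X → Graph.V T)
          (U : Graph) (labU : X → Graph.V U)
          → IsTree X T labT
          → (nU : IsNetwork X U labU)
          → ThreeCuttable U
          → (e : Graph.E U) → ¬ CutEdge U e
          → (D : ElimData U e)
          → let open Elim U labU nU e D in
            (IsNetwork X U' lab' × ThreeCuttable U')
            × (Displays T labT U' lab' → Displays T labT U labU)
            × (Displays T labT U labU
               → (ϕ : Embedding T labT U labU)
               → (∀ f → ¬ OnPath U e (Embedding.path ϕ f))
               → Displays T labT U' lab')
lemma11 T labT U labU (nT , _) nU cuttable e e-not-cut D =
  (network' , cuttable') , Displays-U'⇒Displays-U nT , λ _ → Displays-U⇒Displays-U' nT
  where open Elimination U labU nU cuttable e e-not-cut D
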